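{- Let $\nu=(\nu_1,\dots,\nu_N)$ be a composition of $n$ and $a$ a positive integer. For an arrangement $w=w(1)\cdots w(n)$ of a deck of composition $\nu$, let $a(w)$ be the number of strict ascents ($i$ with $w(i)<w(i+1)$) and $d(w)$ the number of strict descents ($i$ with $w(i)>w(i+1)$). Then $w\mapsto a(w)-d(w)$ is a right eigenfunction with eigenvalue $1/a$ of the Gilbert–Shannon–Reeds $a$-shuffle Markov chain on arrangements of this deck.
   Context: A deck of composition $\nu$ has $\nu_i$ cards of value $i$; arrangements are words in $\{1,\dots,N\}$ with exactly $\nu_i$ occurrences of $i$. Gilbert–Shannon–Reeds $a$-shuffle: cut the deck into $a$ consecutive packets with sizes $(n_1,\dots,n_a)$ with probability $\binom{n}{n_1,\dots,n_a}/a^n$, then interleave so that all interleavings preserving the order within each packet are equally likely; $K(u,v)$ is the resulting transition probability, and $f$ is a right eigenfunction with eigenvalue $\beta$ if $\sum_vK(u,v)f(v)=\beta f(u)$. -}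

module Defs where

open import Data.Bool using (Bool; true; false; if_then_else_; _∧_)
open import Data.Nat as ℕ using (ℕ; zero; suc; _∸_; _^_; _<ᵇ_; _≡ᵇ_)
open import Data.Nat.Combinatorics using (_C_)
open import Data.Fin as Fin using (Fin; toℕ)
open import Data.Fin.Properties using () renaming (_≟_ to _≟F_)
open import Data.Vec as Vec using (Vec; lookup)
open import Data.List using (List; []; _∷_; map; concatMap; filterᵇ; length; take; drop; upTo; foldr; allFin)
open import Data.Bool.ListAction using (and)
open import Data.Nat.ListAction using (sum)
open import Data.List.Properties using (≡-dec)
open import Data.Maybe using (Maybe; just; nothing)
open import Data.Product using (_×_; _,_)
open import Data.Integer as ℤ using (ℤ; +_)
open import Data.Rational as ℚ using (ℚ; 0ℚ; _+_; _*_)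
open import Relation.Nullary.Decidable using (⌊_⌋)

-- p / q as a rational (only used with q ≠ 0; q = 0 gives 0)
frac : ℕ → ℕ → ℚ
frac p zero    = 0ℚ
frac p (suc q) = (+ p) ℚ./ suc q

sumℚ : List ℚ → ℚ
sumℚ = foldr _+_ 0ℚ

words : {A : Set} → List A → ℕ → List (List A)
words xs zero    = [] ∷ []
words xs (suc n) = concatMap (λ x → map (x ∷_) (words xs n)) xs

-- Decks and arrangements (card values are Fin N, i.e. 1..N shifted to 0..N-1)

countF : {N : ℕ} → Fin N → List (Fin N) → ℕ
countF i w = length (filterᵇ (λ x → ⌊ x ≟F i ⌋) w)

deckSize : {N : ℕ} → Vec ℕ N → ℕ
deckSize = Vec.sum

isArrangement : {N : ℕ} → Vec ℕ N → List (Fin N) → Bool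
isArrangement {N} ν w = and (map (λ i → countF i w ≡ᵇ lookup ν i) (allFin N))

arrangements : {N : ℕ} → Vec ℕ N → List (List (Fin N))
arrangements {N} ν = filterᵇ (isArrangement ν) (words (allFin N) (deckSize ν))

ascents : {N : ℕ} → List (Fin N) → ℕ
ascents (x ∷ y ∷ w) = (if toℕ x <ᵇ toℕ y then 1 else 0) ℕ.+ ascents (y ∷ w)
ascents _ = 0

descents : {N : ℕ} → List (Fin N) → ℕ
descents (x ∷ y ∷ w) = (if toℕ y <ᵇ toℕ x then 1 else 0) ℕ.+ descents (y ∷ w)
descents _ = 0

ascMinusDesc : {N : ℕ} → List (Fin N) → ℚ
ascMinusDesc w = (+ ascents w ℤ.- + descents w) ℚ./ 1

comps : ℕ → ℕ → List (List ℕ)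
comps zero    n = if n ≡ᵇ 0 then [] ∷ [] else []
comps (suc a) n = concatMap (λ k → map (k ∷_) (comps a (n ∸ k))) (upTo (suc n))

multinomial : List ℕ → ℕ
multinomial []       = 1
multinomial (k ∷ ks) = ((k ℕ.+ sum ks) C k) ℕ.* multinomial ks

cut : {A : Set} → List ℕ → List A → List (List A)
cut []       w = []
cut (k ∷ ks) w = take k w ∷ cut ks (drop k w)

countℕ : ℕ → List ℕ → ℕ
countℕ j L = length (filterᵇ (λ x → x ≡ᵇ j) L)

-- interleavings of packets of sizes c = (c₀,…,c_{a-1}): label sequences in
-- {0,…,a-1}^n containing label j exactly c_j times; position k of the
-- shuffled deck receives the next card (from the top) of packet L_k.
interleavings : (a : ℕ) → List ℕ → List (List ℕ)
interleavings a c =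
  filterᵇ (λ L → ⌊ ≡-dec ℕ._≟_ (map (λ j → countℕ j L) (upTo a)) c ⌋)
          (words (upTo a) (sum c))

pop : {A : Set} → ℕ → List (List A) → Maybe (A × List (List A))
pop j       []              = nothing
pop zero    ([] ∷ ps)       = nothing
pop zero    ((x ∷ xs) ∷ ps) = just (x , xs ∷ ps)
pop (suc j) (p ∷ ps) with pop j ps
... | nothing         = nothing
... | just (x , ps′)  = just (x , p ∷ ps′)

interleave : {A : Set} → List (List A) → List ℕ → List A
interleave ps []       = []
interleave ps (j ∷ js) with pop j ps
... | nothing         = []
... | just (x , ps′)  = x ∷ interleave ps′ js

-- transition probability K(u,v) of the GSR a-shuffle:
-- Σ over cuts c of P(cut c) · P(uniform interleaving of the packets yields v)
K : (a : ℕ) {N : ℕ} → List (Fin N) → List (Fin N) → ℚ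
K a u v = sumℚ (map term (comps a n))
  where
  n = length u
  term : List ℕ → ℚ
  term c = frac (multinomial c) (a ^ n)
         * frac (length (filterᵇ (λ L → ⌊ ≡-dec _≟F_ (interleave (cut c u) L) v ⌋)
                                 (interleavings a c)))
                (length (interleavings a c))

IsRightEigenfunction : (a : ℕ) {N : ℕ} (ν : Vec ℕ N) → (List (Fin N) → ℚ) → ℚ → Set
IsRightEigenfunction a ν f β =
  ∀ u → isArrangement ν u ≡ true →
    sumℚ (map (λ v → K a u v * f v) (arrangements ν)) ≡ β * f u
  where open import Relation.Binary.PropositionalEquality using (_≡_)

module Submission where

-- Write f(w) = a(w) − d(w) as the sum of the signs of the adjacent pairs (w(i), w(i+1)).  Cut u into packets
-- P₀ … P_{a−1} of sizes c and sum f over the multinomial(c) interleavings by dealing the first card: if it is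
-- the top x of packet j, the pair it forms with the next card is internal to P_j when that card comes from
-- P_j again, and otherwise is the cross pair (top P_j, top P_k), which occurs with the symmetric weight
-- multinomial(c − e_j − e_k).  The cross pairs cancel by antisymmetry, and induction on n gives
-- Σ_k f(P_k) · multinomial(c − e_k).  In K the weight multinomial(c)/aⁿ of a cut cancels against the number
-- of its interleavings, so Σ_v K(u,v) f(v) = a⁻ⁿ Σ_c Σ_k f(P_k) · multinomial(c − e_k).  Splitting off the
-- first packet, the binomial theorem evaluates this sum over cuts, by induction on a, as a^{n−1} f(u).

open import Defs
open import Data.Nat as ℕ using (ℕ; zero; suc; _∸_; _<_; _≤_; z≤n; s≤s)
import Data.Nat.Properties as ℕ
open import Data.Nat.ListAction using (sum)
open import Data.Nat.Combinatorics using (_C_; nCn≡1; nCk+nC[k+1]≡[n+1]C[k+1])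
open import Data.Integer as ℤ using (ℤ; +_; _+_; _*_; -_; _-_; 0ℤ)
import Data.Integer.Properties as ℤ
open import Data.Integer.Tactic.RingSolver using (solve-∀)
open import Data.Rational as ℚ using (ℚ)
import Data.Rational.Properties as ℚ
open import Data.Rational.Unnormalised as ℚᵘ using (mkℚᵘ)
import Data.Rational.Unnormalised.Properties as ℚᵘ
open import Data.Fin as Fin using (Fin; toℕ)
open import Data.Fin.Properties using (toℕ<n; toℕ-inject₁; toℕ-fromℕ; suc-injective) renaming (_≟_ to _≟F_)
open import Data.Vec as Vec using (Vec; lookup)
open import Data.List
  using (List; []; _∷_; _++_; map; concat; concatMap; filterᵇ; length; upTo; applyUpTo; take; drop; tabulate; allFin)
open import Data.List.Properties
  using (≡-dec; length-map; length-upTo; map-upTo; map-cong; length-take; length-drop; drop-all; take++drop≡id)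
open import Data.List.Relation.Unary.All as All using (All; []; _∷_)
open import Data.List.Relation.Unary.All.Properties
  using (concat⁺; map⁺; all-upTo; filter⁺; all-filter; all⁺; tabulate⁻)
open import Data.List.Relation.Binary.Permutation.Propositional
  using (_↭_; ↭-refl; ↭-reflexive; ↭-sym; ↭-trans; prep)
open import Data.List.Relation.Binary.Permutation.Propositional.Properties
  using (++⁺ˡ; shift; ↭-length; filter-↭)
open import Data.Product using (_×_; _,_; proj₂)
open import Function.Bundles using (_⇔_; mk⇔; Equivalence)
open import Data.Bool using (Bool; true; false; if_then_else_)
open import Data.Bool.ListAction using (and)
open import Data.Bool.Properties using (T-≡)
open import Data.Maybe using (just)
open import Function using (_∘_)
open import Relation.Nullary using (yes; no; contradiction)
open import Relation.Nullary.Decidable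
  using (Dec; ⌊_⌋; T?; toWitness; isYes≗does; does-⇔; dec-true; dec-false; ⌊⌋-map′)
open import Relation.Binary.PropositionalEquality
open import Algebra.Properties.Semiring.Sum ℤ.+-*-semiring
  using (sum-syntax; sum-cong-≗; ∑-distrib-+; ∑-comm; *-distribˡ-sum; sum-replicate-zero; sum-init-last)
open import Algebra.Properties.Semiring.Mult ℤ.+-*-semiring using () renaming (_×_ to _·_)
open import Algebra.Properties.Semiring.Exp ℤ.+-*-semiring using () renaming (_^_ to _^ₛ_)
open import Algebra.Properties.CommutativeSemiring.Binomial ℤ.+-*-commutativeSemiring
  using (theorem; binomialExpansion)

∑ᴸ : {A : Set} → List A → (A → ℤ) → ℤ
∑ᴸ []       h = 0ℤ
∑ᴸ (x ∷ xs) h = h x + ∑ᴸ xs h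

infixl 10 ∑ᴸ
syntax ∑ᴸ xs (λ x → e) = ∑[ x ∈ xs ] e

module _ {A : Set} where

  ∑ᴸ-cong : (xs : List A) {h g : A → ℤ} → (∀ x → h x ≡ g x) → ∑ᴸ xs h ≡ ∑ᴸ xs g
  ∑ᴸ-cong []       h≗g = refl
  ∑ᴸ-cong (x ∷ xs) h≗g = cong₂ _+_ (h≗g x) (∑ᴸ-cong xs h≗g)

  ∑ᴸ-cong-All : {P : A → Set} {xs : List A} → All P xs → {h g : A → ℤ} →
                (∀ x → P x → h x ≡ g x) → ∑ᴸ xs h ≡ ∑ᴸ xs g
  ∑ᴸ-cong-All []         h≗g = refl
  ∑ᴸ-cong-All (px ∷ pxs) h≗g = cong₂ _+_ (h≗g _ px) (∑ᴸ-cong-All pxs h≗g)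

  ∑ᴸ-++ : (xs ys : List A) (h : A → ℤ) → ∑ᴸ (xs ++ ys) h ≡ ∑ᴸ xs h + ∑ᴸ ys h
  ∑ᴸ-++ []       ys h = sym (ℤ.+-identityˡ _)
  ∑ᴸ-++ (x ∷ xs) ys h = trans (cong (_+_ (h x)) (∑ᴸ-++ xs ys h)) (sym (ℤ.+-assoc (h x) _ _))

  ∑ᴸ-distrib-+ : (xs : List A) (h g : A → ℤ) → ∑[ x ∈ xs ] (h x + g x) ≡ ∑ᴸ xs h + ∑ᴸ xs g
  ∑ᴸ-distrib-+ []       h g = refl
  ∑ᴸ-distrib-+ (x ∷ xs) h g =
    trans (cong (_+_ (h x + g x)) (∑ᴸ-distrib-+ xs h g)) (middle-swap (h x) (g x) _ _)
    where
    middle-swap : ∀ (a b c d : ℤ) → (a + b) + (c + d) ≡ (a + c) + (b + d)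
    middle-swap = solve-∀

  *-distribˡ-∑ᴸ : (c : ℤ) (xs : List A) (h : A → ℤ) → c * ∑ᴸ xs h ≡ ∑[ x ∈ xs ] (c * h x)
  *-distribˡ-∑ᴸ c []       h = ℤ.*-zeroʳ c
  *-distribˡ-∑ᴸ c (x ∷ xs) h = trans (ℤ.*-distribˡ-+ c (h x) _) (cong (_+_ (c * h x)) (*-distribˡ-∑ᴸ c xs h))

  *-distribʳ-∑ᴸ : (c : ℤ) (xs : List A) (h : A → ℤ) → ∑ᴸ xs h * c ≡ ∑[ x ∈ xs ] (h x * c)
  *-distribʳ-∑ᴸ c xs h = trans (ℤ.*-comm _ c)
    (trans (*-distribˡ-∑ᴸ c xs h) (∑ᴸ-cong xs (λ x → ℤ.*-comm c (h x))))

  ∑ᴸ-const : (xs : List A) (c : ℤ) → ∑[ x ∈ xs ] c ≡ c * + length xs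
  ∑ᴸ-const []       c = sym (ℤ.*-zeroʳ c)
  ∑ᴸ-const (x ∷ xs) c = begin
    c + ∑[ x ∈ xs ] c       ≡⟨ cong (_+_ c) (∑ᴸ-const xs c) ⟩
    c + c * + length xs     ≡⟨ cong (_+ c * + length xs) (sym (ℤ.*-identityʳ c)) ⟩
    c * + 1 + c * + length xs ≡⟨ sym (ℤ.*-distribˡ-+ c (+ 1) (+ length xs)) ⟩
    c * + suc (length xs)   ∎
    where open ≡-Reasoning

  ∑ᴸ-one : (xs : List A) → ∑[ x ∈ xs ] (+ 1) ≡ + length xs
  ∑ᴸ-one xs = trans (∑ᴸ-const xs (+ 1)) (ℤ.*-identityˡ _)

  ∑ᴸ-zero : (xs : List A) → ∑[ x ∈ xs ] 0ℤ ≡ 0ℤ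
  ∑ᴸ-zero xs = ∑ᴸ-const xs 0ℤ

  ∑ᴸ-filterᵇ : (p : A → Bool) (xs : List A) (h : A → ℤ) →
               ∑ᴸ (filterᵇ p xs) h ≡ ∑[ x ∈ xs ] (if p x then h x else 0ℤ)
  ∑ᴸ-filterᵇ p []       h = refl
  ∑ᴸ-filterᵇ p (x ∷ xs) h with p x
  ... | true  = cong (_+_ (h x)) (∑ᴸ-filterᵇ p xs h)
  ... | false = trans (∑ᴸ-filterᵇ p xs h) (sym (ℤ.+-identityˡ _))

module _ {A B : Set} where

  ∑ᴸ-map : (f : A → B) (xs : List A) (h : B → ℤ) → ∑ᴸ (map f xs) h ≡ ∑ᴸ xs (h ∘ f)
  ∑ᴸ-map f []       h = refl
  ∑ᴸ-map f (x ∷ xs) h = cong (_+_ (h (f x))) (∑ᴸ-map f xs h)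

  ∑ᴸ-concatMap : (f : A → List B) (xs : List A) (h : B → ℤ) →
                 ∑ᴸ (concatMap f xs) h ≡ ∑[ x ∈ xs ] ∑ᴸ (f x) h
  ∑ᴸ-concatMap f []       h = refl
  ∑ᴸ-concatMap f (x ∷ xs) h = trans (∑ᴸ-++ (f x) _ h) (cong (_+_ (∑ᴸ (f x) h)) (∑ᴸ-concatMap f xs h))

  ∑ᴸ-comm : (xs : List A) (ys : List B) (F : A → B → ℤ) →
            ∑[ x ∈ xs ] ∑[ y ∈ ys ] F x y ≡ ∑[ y ∈ ys ] ∑[ x ∈ xs ] F x y
  ∑ᴸ-comm []       ys F = sym (∑ᴸ-zero ys)
  ∑ᴸ-comm (x ∷ xs) ys F =
    trans (cong (_+_ (∑ᴸ ys (F x))) (∑ᴸ-comm xs ys F)) (sym (∑ᴸ-distrib-+ ys (F x) _))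

∑ᴸ-applyUpTo : (f : ℕ → ℕ) (n : ℕ) (h : ℕ → ℤ) → ∑ᴸ (applyUpTo f n) h ≡ ∑[ i < n ] h (f (toℕ i))
∑ᴸ-applyUpTo f zero    h = refl
∑ᴸ-applyUpTo f (suc n) h = cong (_+_ (h (f 0))) (∑ᴸ-applyUpTo (f ∘ suc) n h)

∑ᴸ-upTo : (n : ℕ) (h : ℕ → ℤ) → ∑ᴸ (upTo n) h ≡ ∑[ i < n ] h (toℕ i)
∑ᴸ-upTo = ∑ᴸ-applyUpTo (λ i → i)

∑-antisym : ∀ n (F : Fin n → Fin n → ℤ) → (∀ i j → F i j ≡ - F j i) → ∑[ i < n ] ∑[ j < n ] F i j ≡ 0ℤ
∑-antisym n F F-antisym = self-negating S (begin
  S                                      ≡⟨ ∑-comm F ⟩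
  ∑[ j < n ] ∑[ i < n ] F i j            ≡⟨ sum-cong-≗ (λ j → sum-cong-≗ (λ i → F-antisym i j)) ⟩
  ∑[ j < n ] ∑[ i < n ] (- F j i)         ≡⟨ sum-cong-≗ (λ j → sym (negate (λ i → F j i))) ⟩
  ∑[ j < n ] (- ∑[ i < n ] F j i)         ≡⟨ sym (negate (λ j → ∑[ i < n ] F j i)) ⟩
  - S                                    ∎)
  where
  open ≡-Reasoning
  S = ∑[ i < n ] ∑[ j < n ] F i j
  negate : (g : Fin n → ℤ) → - ∑[ i < n ] g i ≡ ∑[ i < n ] (- g i)
  negate g = trans (sym (ℤ.-1*i≡-i _))
    (trans (*-distribˡ-sum ℤ.-1ℤ g) (sum-cong-≗ (λ i → ℤ.-1*i≡-i (g i))))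
  self-negating : ∀ x → x ≡ - x → x ≡ 0ℤ
  self-negating (+ zero)    _  = refl
  self-negating (+ suc _)   ()
  self-negating ℤ.-[1+ _ ] ()

∑-last : ∀ n (h : ℕ → ℤ) → ∑[ i < suc n ] h (toℕ i) ≡ ∑[ i < n ] h (toℕ i) + h n
∑-last n h = trans (sum-init-last {n} (h ∘ toℕ))
  (cong₂ _+_ (sum-cong-≗ {n} (cong h ∘ toℕ-inject₁)) (cong h (toℕ-fromℕ n)))

-- The library's binomial theorem is stated with the generic semiring multiple _·_ and power _^ₛ_.
·-is-* : ∀ m z → m · z ≡ + m * z
·-is-* zero    z = refl
·-is-* (suc m) z = trans (cong (_+_ z) (·-is-* m z)) (sym (ℤ.suc-* (+ m) z))

pos-^ : ∀ a m → (+ a) ^ₛ m ≡ + (a ℕ.^ m)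
pos-^ a zero    = refl
pos-^ a (suc m) = trans (cong (_*_ (+ a)) (pos-^ a m)) (sym (ℤ.pos-* a (a ℕ.^ m)))

binomial : ∀ m a → ∑[ i < suc m ] (+ (m C toℕ i) * + (a ℕ.^ (m ∸ toℕ i))) ≡ + (suc a ℕ.^ m)
binomial m a = sym (begin
  + (suc a ℕ.^ m)                    ≡⟨ pos-^ (suc a) m ⟨
  (+ 1 + + a) ^ₛ m                   ≡⟨ theorem m (+ 1) (+ a) ⟩
  binomialExpansion (+ 1) (+ a) m    ≡⟨ sum-cong-≗ {suc m} term ⟩
  ∑[ i < suc m ] (+ (m C toℕ i) * + (a ℕ.^ (m ∸ toℕ i))) ∎)
  where
  open ≡-Reasoning
  term : ∀ i → (m C toℕ i) · ((+ 1) ^ₛ toℕ i * (+ a) ^ₛ (m ∸ toℕ i)) ≡ + (m C toℕ i) * + (a ℕ.^ (m ∸ toℕ i))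
  term i = trans (·-is-* (m C toℕ i) _) (cong (_*_ (+ (m C toℕ i)))
    (trans (cong₂ _*_ (trans (pos-^ 1 (toℕ i)) (cong +_ (ℕ.^-zeroˡ (toℕ i)))) (pos-^ a (m ∸ toℕ i)))
           (ℤ.*-identityˡ _)))

-- Packet sizes and multinomial coefficients

nth : List ℕ → ℕ → ℕ
nth []       _       = 0
nth (x ∷ xs) zero    = x
nth (x ∷ xs) (suc j) = nth xs j

incAt decAt : ℕ → List ℕ → List ℕ
incAt _       []       = []
incAt zero    (x ∷ xs) = suc x ∷ xs
incAt (suc j) (x ∷ xs) = x ∷ incAt j xs
decAt _       []       = []
decAt zero    (x ∷ xs) = x ∸ 1 ∷ xs
decAt (suc j) (x ∷ xs) = x ∷ decAt j xs

ifNonZero : ℕ → ℤ → ℤ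
ifNonZero zero    x = 0ℤ
ifNonZero (suc _) x = x

ifNonZero-*ˡ : ∀ n (x y : ℤ) → ifNonZero n (x * y) ≡ x * ifNonZero n y
ifNonZero-*ˡ zero    x y = sym (ℤ.*-zeroʳ x)
ifNonZero-*ˡ (suc n) x y = refl

nth-ext : (xs ys : List ℕ) → length xs ≡ length ys → (∀ i → i < length xs → nth xs i ≡ nth ys i) → xs ≡ ys
nth-ext []       []       _  _ = refl
nth-ext (x ∷ xs) (y ∷ ys) eq e =
  cong₂ _∷_ (e 0 (s≤s z≤n)) (nth-ext xs ys (ℕ.suc-injective eq) (λ i i<n → e (suc i) (s≤s i<n)))

sum≡0⇒nth≡0 : ∀ c i → sum c ≡ 0 → nth c i ≡ 0
sum≡0⇒nth≡0 []          i       _  = refl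
sum≡0⇒nth≡0 (zero ∷ c)  zero    _  = refl
sum≡0⇒nth≡0 (zero ∷ c)  (suc i) eq = sum≡0⇒nth≡0 c i eq

length-incAt : ∀ j xs → length (incAt j xs) ≡ length xs
length-incAt _       []       = refl
length-incAt zero    (x ∷ xs) = refl
length-incAt (suc j) (x ∷ xs) = cong suc (length-incAt j xs)

length-decAt : ∀ j xs → length (decAt j xs) ≡ length xs
length-decAt _       []       = refl
length-decAt zero    (x ∷ xs) = refl
length-decAt (suc j) (x ∷ xs) = cong suc (length-decAt j xs)

nth-incAt : ∀ j xs i → i < length xs → nth (incAt j xs) i ≡ (if j ℕ.≡ᵇ i then suc (nth xs i) else nth xs i)
nth-incAt zero    (x ∷ xs) zero    _         = refl
nth-incAt zero    (x ∷ xs) (suc i) _         = refl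
nth-incAt (suc j) (x ∷ xs) zero    _         = refl
nth-incAt (suc j) (x ∷ xs) (suc i) (s≤s i<n) = nth-incAt j xs i i<n

nth-decAt-≡ : ∀ j xs → nth (decAt j xs) j ≡ nth xs j ∸ 1
nth-decAt-≡ zero    []       = refl
nth-decAt-≡ (suc j) []       = refl
nth-decAt-≡ zero    (x ∷ xs) = refl
nth-decAt-≡ (suc j) (x ∷ xs) = nth-decAt-≡ j xs

nth-decAt-≢ : ∀ j xs i → j ≢ i → nth (decAt j xs) i ≡ nth xs i
nth-decAt-≢ _       []       _       _   = refl
nth-decAt-≢ zero    (x ∷ xs) zero    j≢i = contradiction refl j≢i
nth-decAt-≢ zero    (x ∷ xs) (suc i) _   = refl
nth-decAt-≢ (suc j) (x ∷ xs) zero    _   = refl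
nth-decAt-≢ (suc j) (x ∷ xs) (suc i) j≢i = nth-decAt-≢ j xs i (j≢i ∘ cong suc)

decAt-incAt : ∀ j xs → decAt j (incAt j xs) ≡ xs
decAt-incAt _       []       = refl
decAt-incAt zero    (x ∷ xs) = refl
decAt-incAt (suc j) (x ∷ xs) = cong (x ∷_) (decAt-incAt j xs)

incAt-decAt : ∀ j xs → 1 ≤ nth xs j → incAt j (decAt j xs) ≡ xs
incAt-decAt zero    (suc x ∷ xs) _ = refl
incAt-decAt (suc j) (x ∷ xs)     p = cong (x ∷_) (incAt-decAt j xs p)

nth-incAt-≡ : ∀ j xs → j < length xs → nth (incAt j xs) j ≡ suc (nth xs j)
nth-incAt-≡ zero    (x ∷ xs) _         = refl
nth-incAt-≡ (suc j) (x ∷ xs) (s≤s j<n) = nth-incAt-≡ j xs j<n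

decAt-comm : ∀ j k xs → decAt j (decAt k xs) ≡ decAt k (decAt j xs)
decAt-comm _       _       []       = refl
decAt-comm zero    zero    (x ∷ xs) = refl
decAt-comm zero    (suc k) (x ∷ xs) = refl
decAt-comm (suc j) zero    (x ∷ xs) = refl
decAt-comm (suc j) (suc k) (x ∷ xs) = cong (x ∷_) (decAt-comm j k xs)

sum-decAt : ∀ j xs {r} → nth xs j ≡ suc r → sum xs ≡ suc (sum (decAt j xs))
sum-decAt zero    (suc x ∷ xs) _  = refl
sum-decAt (suc j) (x ∷ xs)     eq = trans (cong (x ℕ.+_) (sum-decAt j xs eq)) (ℕ.+-suc x _)

pascal : ∀ k s → (suc k ℕ.+ suc s) C suc k ≡ (k ℕ.+ suc s) C k ℕ.+ (suc k ℕ.+ s) C suc k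
pascal k s = trans (sym (nCk+nC[k+1]≡[n+1]C[k+1] (k ℕ.+ suc s) k))
                   (cong (λ n → (k ℕ.+ suc s) C k ℕ.+ n C suc k) (ℕ.+-suc k s))

[n+0]Cn≡1 : ∀ n → (n ℕ.+ 0) C n ≡ 1
[n+0]Cn≡1 n = trans (cong (_C n) (ℕ.+-identityʳ n)) (nCn≡1 n)

multinomial-0 : ∀ c → sum c ≡ 0 → multinomial c ≡ 1
multinomial-0 []         _  = refl
multinomial-0 (zero ∷ c) sc = trans (ℕ.+-identityʳ _) (multinomial-0 c sc)

pascal-multinomial : ∀ k s M → + (((k ℕ.+ suc s) C k) ℕ.* M) ≡
                     ifNonZero k (+ ((((k ∸ 1) ℕ.+ suc s) C (k ∸ 1)) ℕ.* M)) + + ((k ℕ.+ s) C k) * + M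
pascal-multinomial zero    s M = trans (ℤ.pos-* ((0 ℕ.+ suc s) C 0) M) (sym (ℤ.+-identityˡ _))
pascal-multinomial (suc k) s M = begin
  + (((suc k ℕ.+ suc s) C suc k) ℕ.* M)  ≡⟨ cong (λ n → + (n ℕ.* M)) (pascal k s) ⟩
  + ((C₁ ℕ.+ C₂) ℕ.* M)                  ≡⟨ cong +_ (ℕ.*-distribʳ-+ M C₁ C₂) ⟩
  + (C₁ ℕ.* M ℕ.+ C₂ ℕ.* M)              ≡⟨ ℤ.pos-+ (C₁ ℕ.* M) (C₂ ℕ.* M) ⟩
  + (C₁ ℕ.* M) + + (C₂ ℕ.* M)            ≡⟨ cong (_+_ (+ (C₁ ℕ.* M))) (ℤ.pos-* C₂ M) ⟩
  + (C₁ ℕ.* M) + + C₂ * + M              ∎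
  where
  open ≡-Reasoning
  C₁ = (k ℕ.+ suc s) C k
  C₂ = (suc k ℕ.+ s) C suc k

multinomial-rec : ∀ a c {m} → length c ≡ a → sum c ≡ suc m →
  + multinomial c ≡ ∑[ j < a ] ifNonZero (nth c (toℕ j)) (+ multinomial (decAt (toℕ j) c))
multinomial-rec _ (k ∷ c) refl sc with sum c in Σc
multinomial-rec _ (zero  ∷ c) refl () | zero
multinomial-rec _ (suc k ∷ c) refl _  | zero =
  trans (cong (λ n → + (n ℕ.* multinomial c)) (trans ([n+0]Cn≡1 (suc k)) (sym ([n+0]Cn≡1 k))))
        (trans (sym (ℤ.+-identityʳ _)) (cong (_+_ (+ (((k ℕ.+ 0) C k) ℕ.* multinomial c))) (sym rest≡0)))
  where
  rest : ℕ → ℤ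
  rest j = + multinomial (suc k ∷ decAt j c)
  rest≡0 : ∑[ j < length c ] ifNonZero (nth c (toℕ j)) (rest (toℕ j)) ≡ 0ℤ
  rest≡0 = trans
    (sum-cong-≗ {length c} (λ j → cong (λ n → ifNonZero n (rest (toℕ j))) (sum≡0⇒nth≡0 c (toℕ j) Σc)))
    (sum-replicate-zero (length c))
multinomial-rec _ (k ∷ c) refl _ | suc s = begin
  + (((k ℕ.+ suc s) C k) ℕ.* multinomial c)
    ≡⟨ pascal-multinomial k s (multinomial c) ⟩
  first + B * + multinomial c
    ≡⟨ cong (λ x → first + B * x) (multinomial-rec (length c) c refl Σc) ⟩
  first + B * ∑[ j < length c ] R (toℕ j)
    ≡⟨ cong (_+_ first) (*-distribˡ-sum {length c} B (R ∘ toℕ)) ⟩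
  first + ∑[ j < length c ] (B * R (toℕ j))
    ≡⟨ cong (_+_ first) (sum-cong-≗ {length c} (λ j → rest (toℕ j))) ⟩
  first + ∑[ j < length c ] ifNonZero (nth c (toℕ j)) (+ multinomial (k ∷ decAt (toℕ j) c)) ∎
  where
  open ≡-Reasoning
  first = ifNonZero k (+ ((((k ∸ 1) ℕ.+ suc s) C (k ∸ 1)) ℕ.* multinomial c))
  B = + ((k ℕ.+ s) C k)
  R : ℕ → ℤ
  R j = ifNonZero (nth c j) (+ multinomial (decAt j c))
  rest : ∀ j → B * R j ≡ ifNonZero (nth c j) (+ multinomial (k ∷ decAt j c))
  rest j with nth c j in c[j]
  ... | zero  = ℤ.*-zeroʳ B
  ... | suc _ = sym (trans (cong (λ n → + (((k ℕ.+ n) C k) ℕ.* multinomial (decAt j c)))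
                                 (ℕ.suc-injective (trans (sym (sum-decAt j c c[j])) Σc)))
                           (ℤ.pos-* ((k ℕ.+ s) C k) (multinomial (decAt j c))))

[k+s]Ck>0 : ∀ k s → 0 < (k ℕ.+ s) C k
[k+s]Ck>0 zero    s = s≤s z≤n
[k+s]Ck>0 (suc k) s = subst (0 <_) (nCk+nC[k+1]≡[n+1]C[k+1] (k ℕ.+ s) k)
                            (ℕ.<-≤-trans ([k+s]Ck>0 k s) (ℕ.m≤m+n _ _))

multinomial>0 : ∀ c → 0 < multinomial c
multinomial>0 []      = s≤s z≤n
multinomial>0 (k ∷ c) = ℕ.*-mono-< {0} {_} {0} ([k+s]Ck>0 k (sum c)) (multinomial>0 c)

multinomial-rec-decAt : ∀ a c k → length c ≡ a → 2 ≤ nth c k →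
  ∑[ j < a ] ifNonZero (nth c (toℕ j)) (+ multinomial (decAt k (decAt (toℕ j) c))) ≡ + multinomial (decAt k c)
multinomial-rec-decAt a c k lc 2≤c[k] with nth c k in c[k] | 2≤c[k]
... | suc zero    | s≤s ()
... | suc (suc t) | _ = sym (trans
  (multinomial-rec a (decAt k c) (trans (length-decAt k c) lc) (sum-decAt k (decAt k c) c′[k]))
  (sum-cong-≗ {a} (λ j → same-term (toℕ j))))
  where
  c′[k] : nth (decAt k c) k ≡ suc t
  c′[k] = trans (nth-decAt-≡ k c) (cong (_∸ 1) c[k])
  same-term : ∀ j → ifNonZero (nth (decAt k c) j) (+ multinomial (decAt j (decAt k c)))
                  ≡ ifNonZero (nth c j) (+ multinomial (decAt k (decAt j c)))
  same-term j rewrite decAt-comm j k c with k ℕ.≟ j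
  ... | yes refl rewrite c′[k] | c[k] = refl
  ... | no k≢j   rewrite nth-decAt-≢ k c j k≢j = refl

counts : ℕ → List ℕ → List ℕ
counts a L = map (λ j → countℕ j L) (upTo a)

length-counts : ∀ a L → length (counts a L) ≡ a
length-counts a L = trans (length-map _ (upTo a)) (length-upTo a)

nth-applyUpTo : ∀ (f : ℕ → ℕ) n i → i < n → nth (applyUpTo f n) i ≡ f i
nth-applyUpTo f (suc n) zero    _         = refl
nth-applyUpTo f (suc n) (suc i) (s≤s i<n) = nth-applyUpTo (f ∘ suc) n i i<n

nth-counts : ∀ a L i → i < a → nth (counts a L) i ≡ countℕ i L
nth-counts a L i i<a = trans (cong (λ xs → nth xs i) (map-upTo _ a)) (nth-applyUpTo _ a i i<a)

countℕ-∷ : ∀ i j L → countℕ i (j ∷ L) ≡ (if j ℕ.≡ᵇ i then suc (countℕ i L) else countℕ i L)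
countℕ-∷ i j L with j ℕ.≡ᵇ i
... | true  = refl
... | false = refl

counts-∷ : ∀ a j L → j < a → counts a (j ∷ L) ≡ incAt j (counts a L)
counts-∷ a j L j<a = nth-ext (counts a (j ∷ L)) (incAt j (counts a L))
  (trans (length-counts a (j ∷ L)) (sym (trans (length-incAt j (counts a L)) (length-counts a L))))
  λ i i<n → let i<a = subst (i <_) (length-counts a (j ∷ L)) i<n in begin
    nth (counts a (j ∷ L)) i                               ≡⟨ nth-counts a (j ∷ L) i i<a ⟩
    countℕ i (j ∷ L)                                       ≡⟨ countℕ-∷ i j L ⟩
    (if j ℕ.≡ᵇ i then suc (countℕ i L) else countℕ i L)
                                  ≡⟨ cong (λ n → if j ℕ.≡ᵇ i then suc n else n) (nth-counts a L i i<a) ⟨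
    (if j ℕ.≡ᵇ i then suc (nth (counts a L) i) else nth (counts a L) i)
                                  ≡⟨ nth-incAt j (counts a L) i (subst (i <_) (sym (length-counts a L)) i<a) ⟨
    nth (incAt j (counts a L)) i                           ∎
  where open ≡-Reasoning

counts-[] : ∀ a c → length c ≡ a → sum c ≡ 0 → counts a [] ≡ c
counts-[] a c refl sc = nth-ext (counts (length c) []) c (length-counts (length c) [])
  λ i i<n → trans (nth-counts (length c) [] i (subst (i <_) (length-counts (length c) []) i<n))
                  (sym (sum≡0⇒nth≡0 c i sc))

incAt-≡⇒ : ∀ j d c → j < length d → incAt j d ≡ c → 1 ≤ nth c j × d ≡ decAt j c
incAt-≡⇒ j d c j<n refl = subst (1 ≤_) (sym (nth-incAt-≡ j d j<n)) (s≤s z≤n) , sym (decAt-incAt j d)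

counts-∷-⇔ : ∀ a c j L {r} → j < a → nth c j ≡ suc r → counts a (j ∷ L) ≡ c ⇔ counts a L ≡ decAt j c
counts-∷-⇔ a c j L {r} j<a c[j]≡1+r = mk⇔
  (λ eq → proj₂ (incAt-≡⇒ j (counts a L) c j<n (trans (sym (counts-∷ a j L j<a)) eq)))
  (λ eq → trans (counts-∷ a j L j<a)
                 (trans (cong (incAt j) eq) (incAt-decAt j c (subst (1 ≤_) (sym c[j]≡1+r) (s≤s z≤n)))))
  where j<n = subst (j <_) (sym (length-counts a L)) j<a

counts-∷-≢ : ∀ a c j L → j < a → nth c j ≡ 0 → counts a (j ∷ L) ≢ c
counts-∷-≢ a c j L j<a c[j]≡0 eq
  with incAt-≡⇒ j (counts a L) c (subst (j <_) (sym (length-counts a L)) j<a) (trans (sym (counts-∷ a j L j<a)) eq)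
... | 1≤c[j] , _ = contradiction (subst (1 ≤_) c[j]≡0 1≤c[j]) λ ()

isInterleaving : ℕ → List ℕ → List ℕ → Bool
isInterleaving a c L = ⌊ ≡-dec ℕ._≟_ (counts a L) c ⌋

isInterleaving-∷ : ∀ a c j L {r} → j < a → nth c j ≡ suc r →
                   isInterleaving a c (j ∷ L) ≡ isInterleaving a (decAt j c) L
isInterleaving-∷ a c j L j<a c[j]≡1+r = trans (isYes≗does before)
  (trans (does-⇔ (counts-∷-⇔ a c j L j<a c[j]≡1+r) before after) (sym (isYes≗does after)))
  where
  before = ≡-dec ℕ._≟_ (counts a (j ∷ L)) c
  after  = ≡-dec ℕ._≟_ (counts a L) (decAt j c)

isInterleaving-∷-0 : ∀ a c j L → j < a → nth c j ≡ 0 → isInterleaving a c (j ∷ L) ≡ false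
isInterleaving-∷-0 a c j L j<a c[j]≡0 = trans (isYes≗does dec) (dec-false dec (counts-∷-≢ a c j L j<a c[j]≡0))
  where dec = ≡-dec ℕ._≟_ (counts a (j ∷ L)) c

∑ᴸ-interleavings-[] : ∀ a c (g : List ℕ → ℤ) → length c ≡ a → sum c ≡ 0 → ∑ᴸ (interleavings a c) g ≡ g []
∑ᴸ-interleavings-[] a c g lc sc = begin
  ∑ᴸ (interleavings a c) g
    ≡⟨ ∑ᴸ-filterᵇ (isInterleaving a c) (words (upTo a) (sum c)) g ⟩
  ∑[ L ∈ words (upTo a) (sum c) ] (if isInterleaving a c L then g L else 0ℤ)
    ≡⟨ cong (λ n → ∑[ L ∈ words (upTo a) n ] (if isInterleaving a c L then g L else 0ℤ)) sc ⟩
  (if isInterleaving a c [] then g [] else 0ℤ) + 0ℤ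
    ≡⟨ cong (λ b → (if b then g [] else 0ℤ) + 0ℤ) (trans (isYes≗does dec) (dec-true dec (counts-[] a c lc sc))) ⟩
  g [] + 0ℤ
    ≡⟨ ℤ.+-identityʳ _ ⟩
  g [] ∎
  where
  open ≡-Reasoning
  dec = ≡-dec ℕ._≟_ (counts a []) c

∑ᴸ-interleavings-∷ : ∀ a c {m} (g : List ℕ → ℤ) → length c ≡ a → sum c ≡ suc m →
  ∑ᴸ (interleavings a c) g ≡
  ∑[ j < a ] ifNonZero (nth c (toℕ j)) (∑[ L ∈ interleavings a (decAt (toℕ j) c) ] g (toℕ j ∷ L))
∑ᴸ-interleavings-∷ a c {m} g lc sc = begin
  ∑ᴸ (interleavings a c) g
    ≡⟨ ∑ᴸ-filterᵇ (isInterleaving a c) (words (upTo a) (sum c)) g ⟩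
  ∑[ L ∈ words (upTo a) (sum c) ] restrict L
    ≡⟨ cong (λ n → ∑[ L ∈ words (upTo a) n ] restrict L) sc ⟩
  ∑[ L ∈ concatMap (λ j → map (j ∷_) (words (upTo a) m)) (upTo a) ] restrict L
    ≡⟨ ∑ᴸ-concatMap _ (upTo a) _ ⟩
  ∑[ j ∈ upTo a ] ∑[ L ∈ map (j ∷_) (words (upTo a) m) ] restrict L
    ≡⟨ ∑ᴸ-cong (upTo a) (λ j → ∑ᴸ-map (j ∷_) (words (upTo a) m) _) ⟩
  ∑[ j ∈ upTo a ] ∑[ L ∈ words (upTo a) m ] restrict (j ∷ L)
    ≡⟨ ∑ᴸ-upTo a _ ⟩
  ∑[ j < a ] ∑[ L ∈ words (upTo a) m ] restrict (toℕ j ∷ L)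
    ≡⟨ sum-cong-≗ (λ j → first-label (toℕ j) (toℕ<n j)) ⟩
  ∑[ j < a ] ifNonZero (nth c (toℕ j)) (∑[ L ∈ interleavings a (decAt (toℕ j) c) ] g (toℕ j ∷ L)) ∎
  where
  open ≡-Reasoning
  restrict : List ℕ → ℤ
  restrict L = if isInterleaving a c L then g L else 0ℤ

  first-label : ∀ j → j < a → ∑[ L ∈ words (upTo a) m ] restrict (j ∷ L)
                            ≡ ifNonZero (nth c j) (∑[ L ∈ interleavings a (decAt j c) ] g (j ∷ L))
  first-label j j<a with nth c j in c[j]
  ... | zero = trans (∑ᴸ-cong (words (upTo a) m)
                       (λ L → cong (λ b → if b then g (j ∷ L) else 0ℤ) (isInterleaving-∷-0 a c j L j<a c[j])))
                     (∑ᴸ-zero (words (upTo a) m))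
  ... | suc r = begin
    ∑[ L ∈ words (upTo a) m ] restrict (j ∷ L)
      ≡⟨ ∑ᴸ-cong (words (upTo a) m)
           (λ L → cong (λ b → if b then g (j ∷ L) else 0ℤ) (isInterleaving-∷ a c j L j<a c[j])) ⟩
    ∑[ L ∈ words (upTo a) m ] (if isInterleaving a (decAt j c) L then g (j ∷ L) else 0ℤ)
      ≡⟨ cong (λ n → ∑[ L ∈ words (upTo a) n ] (if isInterleaving a (decAt j c) L then g (j ∷ L) else 0ℤ))
              (ℕ.suc-injective (trans (sym sc) (sum-decAt j c c[j]))) ⟩
    ∑[ L ∈ words (upTo a) (sum (decAt j c)) ] (if isInterleaving a (decAt j c) L then g (j ∷ L) else 0ℤ)
      ≡⟨ ∑ᴸ-filterᵇ (isInterleaving a (decAt j c)) (words (upTo a) (sum (decAt j c))) (g ∘ (j ∷_)) ⟨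
    ∑[ L ∈ interleavings a (decAt j c) ] g (j ∷ L) ∎

length-interleavings : ∀ a c → length c ≡ a → length (interleavings a c) ≡ multinomial c
length-interleavings a c lc = ℤ.+-injective (by-size (sum c) c lc refl)
  where
  by-size : ∀ m c → length c ≡ a → sum c ≡ m → + length (interleavings a c) ≡ + multinomial c
  by-size zero c lc sc = begin
    + length (interleavings a c)      ≡⟨ ∑ᴸ-one (interleavings a c) ⟨
    ∑[ L ∈ interleavings a c ] (+ 1)  ≡⟨ ∑ᴸ-interleavings-[] a c (λ _ → + 1) lc sc ⟩
    + 1                               ≡⟨ cong +_ (multinomial-0 c sc) ⟨
    + multinomial c                   ∎
    where open ≡-Reasoning
  by-size (suc m) c lc sc = begin
    + length (interleavings a c)      ≡⟨ ∑ᴸ-one (interleavings a c) ⟨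
    ∑[ L ∈ interleavings a c ] (+ 1)  ≡⟨ ∑ᴸ-interleavings-∷ a c (λ _ → + 1) lc sc ⟩
    ∑[ j < a ] ifNonZero (nth c (toℕ j)) (∑[ L ∈ interleavings a (decAt (toℕ j) c) ] (+ 1))
      ≡⟨ sum-cong-≗ {a} (λ j → shorter (toℕ j)) ⟩
    ∑[ j < a ] ifNonZero (nth c (toℕ j)) (+ multinomial (decAt (toℕ j) c))
      ≡⟨ multinomial-rec a c lc sc ⟨
    + multinomial c ∎
    where
    open ≡-Reasoning
    shorter : ∀ j → ifNonZero (nth c j) (∑[ L ∈ interleavings a (decAt j c) ] (+ 1))
                  ≡ ifNonZero (nth c j) (+ multinomial (decAt j c))
    shorter j with nth c j in c[j]
    ... | zero  = refl
    ... | suc _ = trans (∑ᴸ-one (interleavings a (decAt j c)))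
                        (by-size m (decAt j c) (trans (length-decAt j c) lc)
                                 (ℕ.suc-injective (trans (sym (sum-decAt j c c[j])) sc)))

words⁺ : {A : Set} {P : A → Set} {xs : List A} → ∀ m → All P xs → All (All P) (words xs m)
words⁺ zero    pxs = [] ∷ []
words⁺ (suc m) pxs = concat⁺ (map⁺ (All.map (λ px → map⁺ (All.map (px ∷_) (words⁺ m pxs))) pxs))

interleavings-sound : ∀ a c → All (λ L → All (_< a) L × counts a L ≡ c) (interleavings a c)
interleavings-sound a c = All.zipWith (λ (L<a , valid) → L<a , toWitness valid)
  ( filter⁺ (T? ∘ isInterleaving a c) (words⁺ (sum c) (all-upTo a))
  , all-filter (T? ∘ isInterleaving a c) (words (upTo a) (sum c)))

sum-counts-[] : ∀ a → sum (counts a []) ≡ 0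
sum-counts-[] a = trans (cong sum (map-upTo (λ _ → 0) a)) (zeros a)
  where
  zeros : ∀ n → sum (applyUpTo (λ _ → 0) n) ≡ 0
  zeros zero    = refl
  zeros (suc n) = zeros n

module _ {A : Set} where

  sizes : List (List A) → List ℕ
  sizes = map length

  packet : List (List A) → ℕ → List A
  packet []       _       = []
  packet (p ∷ ps) zero    = p
  packet (p ∷ ps) (suc j) = packet ps j

  dropTopAt : ℕ → List (List A) → List (List A)
  dropTopAt _       []       = []
  dropTopAt zero    (p ∷ ps) = drop 1 p ∷ ps
  dropTopAt (suc j) (p ∷ ps) = p ∷ dropTopAt j ps

  nth-sizes : ∀ ps k → nth (sizes ps) k ≡ length (packet ps k)
  nth-sizes []       k       = refl
  nth-sizes (p ∷ ps) zero    = refl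
  nth-sizes (p ∷ ps) (suc k) = nth-sizes ps k

  sizes-dropTopAt : ∀ j ps → sizes (dropTopAt j ps) ≡ decAt j (sizes ps)
  sizes-dropTopAt _       []             = refl
  sizes-dropTopAt zero    ([] ∷ ps)      = refl
  sizes-dropTopAt zero    ((x ∷ p) ∷ ps) = refl
  sizes-dropTopAt (suc j) (p ∷ ps)       = cong (length p ∷_) (sizes-dropTopAt j ps)

  length-dropTopAt : ∀ j ps → length (dropTopAt j ps) ≡ length ps
  length-dropTopAt _       []       = refl
  length-dropTopAt zero    (p ∷ ps) = refl
  length-dropTopAt (suc j) (p ∷ ps) = cong suc (length-dropTopAt j ps)

  packet-dropTopAt-≡ : ∀ j ps → packet (dropTopAt j ps) j ≡ drop 1 (packet ps j)
  packet-dropTopAt-≡ _       []       = refl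
  packet-dropTopAt-≡ zero    (p ∷ ps) = refl
  packet-dropTopAt-≡ (suc j) (p ∷ ps) = packet-dropTopAt-≡ j ps

  packet-dropTopAt-≢ : ∀ j ps k → j ≢ k → packet (dropTopAt j ps) k ≡ packet ps k
  packet-dropTopAt-≢ _       []       _       _   = refl
  packet-dropTopAt-≢ zero    (p ∷ ps) zero    j≢k = contradiction refl j≢k
  packet-dropTopAt-≢ zero    (p ∷ ps) (suc k) _   = refl
  packet-dropTopAt-≢ (suc j) (p ∷ ps) zero    _   = refl
  packet-dropTopAt-≢ (suc j) (p ∷ ps) (suc k) j≢k = packet-dropTopAt-≢ j ps k (j≢k ∘ cong suc)

  packet-empty : ∀ ps k → sum (sizes ps) ≡ 0 → packet ps k ≡ []
  packet-empty []             _       _  = refl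
  packet-empty ([] ∷ ps)      zero    _  = refl
  packet-empty ([] ∷ ps)      (suc k) eq = packet-empty ps k eq

  pop-packet : ∀ j ps {x r} → packet ps j ≡ x ∷ r → pop j ps ≡ just (x , dropTopAt j ps)
  pop-packet zero    ((y ∷ p) ∷ ps) refl = refl
  pop-packet (suc j) (p ∷ ps)       eq   rewrite pop-packet j ps eq = refl

  interleave-∷ : ∀ ps j L {x r} → packet ps j ≡ x ∷ r → interleave ps (j ∷ L) ≡ x ∷ interleave (dropTopAt j ps) L
  interleave-∷ ps j L eq rewrite pop-packet j ps eq = refl

  packetTotal : (List A → ℤ) → ℕ → List (List A) → ℤ
  packetTotal g a ps = ∑[ k < a ] (g (packet ps (toℕ k)) * + multinomial (decAt (toℕ k) (sizes ps)))

  packetTotal-empty : ∀ g a ps → g [] ≡ 0ℤ → sum (sizes ps) ≡ 0 → packetTotal g a ps ≡ 0ℤ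
  packetTotal-empty g a ps g[]≡0 Σc = trans
    (sum-cong-≗ {a} (λ k → cong (_* + multinomial (decAt (toℕ k) (sizes ps)))
                               (trans (cong g (packet-empty ps (toℕ k) Σc)) g[]≡0)))
    (sum-replicate-zero a)

  concat-empty : (ps : List (List A)) → sum (sizes ps) ≡ 0 → concat ps ≡ []
  concat-empty []        _  = refl
  concat-empty ([] ∷ ps) eq = concat-empty ps eq

  concat-dropTopAt : ∀ j (ps : List (List A)) {x r} → packet ps j ≡ x ∷ r → concat ps ↭ x ∷ concat (dropTopAt j ps)
  concat-dropTopAt zero    ((x ∷ r) ∷ ps) refl = ↭-refl
  concat-dropTopAt (suc j) (p ∷ ps)       eq   = ↭-trans (++⁺ˡ p (concat-dropTopAt j ps eq)) (shift _ p _)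

  interleave-↭ : ∀ a (ps : List (List A)) L → All (_< a) L → counts a L ≡ sizes ps → interleave ps L ↭ concat ps
  interleave-↭ a ps []      []          valid =
    ↭-reflexive (sym (concat-empty ps (trans (cong sum (sym valid)) (sum-counts-[] a))))
  interleave-↭ a ps (j ∷ L) (j<a ∷ L<a) valid
    with incAt-≡⇒ j (counts a L) (sizes ps) (subst (j <_) (sym (length-counts a L)) j<a)
                  (trans (sym (counts-∷ a j L j<a)) valid)
  ... | 1≤∣P[j]∣ , valid′ with packet ps j in P[j] | nth-sizes ps j
  ...   | []    | ∣P[j]∣ = contradiction (subst (1 ≤_) ∣P[j]∣ 1≤∣P[j]∣) λ ()
  ...   | x ∷ r | _      rewrite interleave-∷ ps j L P[j] = ↭-trans
    (prep x (interleave-↭ a (dropTopAt j ps) L L<a (trans valid′ (sym (sizes-dropTopAt j ps)))))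
    (↭-sym (concat-dropTopAt j ps P[j]))

  sum≡length-drop : ∀ k c (u : List A) → k ℕ.+ sum c ≡ length u → sum c ≡ length (drop k u)
  sum≡length-drop k c u eq = sym (trans (length-drop k u) (trans (cong (_∸ k) (sym eq)) (ℕ.m+n∸m≡n k (sum c))))

  sizes-cut : ∀ c (u : List A) → sum c ≡ length u → sizes (cut c u) ≡ c
  sizes-cut []      u _  = refl
  sizes-cut (k ∷ c) u eq = cong₂ _∷_ ∣take∣ (sizes-cut c (drop k u) (sum≡length-drop k c u eq))
    where
    ∣take∣ : length (take k u) ≡ k
    ∣take∣ = trans (length-take k u) (ℕ.m≤n⇒m⊓n≡m (subst (k ≤_) eq (ℕ.m≤m+n k (sum c))))

  concat-cut : ∀ c (u : List A) → sum c ≡ length u → concat (cut c u) ≡ u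
  concat-cut []      []      _  = refl
  concat-cut (k ∷ c) u       eq =
    trans (cong (take k u ++_) (concat-cut c (drop k u) (sum≡length-drop k c u eq))) (take++drop≡id k u)

  length-packet-cut : ∀ c (u : List A) j → sum c ≡ length u → length (packet (cut c u) j) ≡ nth c j
  length-packet-cut c u j eq = trans (sym (nth-sizes (cut c u) j)) (cong (λ d → nth d j) (sizes-cut c u eq))

-- Ascents minus descents, summed over interleavings

module _ {N : ℕ} where

  sign : Fin N → Fin N → ℤ
  sign x y = + (if toℕ x ℕ.<ᵇ toℕ y then 1 else 0) - + (if toℕ y ℕ.<ᵇ toℕ x then 1 else 0)

  sign-antisym : ∀ x y → sign x y ≡ - sign y x
  sign-antisym x y = swap-difference (+ (if toℕ x ℕ.<ᵇ toℕ y then 1 else 0)) (+ (if toℕ y ℕ.<ᵇ toℕ x then 1 else 0))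
    where
    swap-difference : ∀ (p q : ℤ) → p - q ≡ - (q - p)
    swap-difference = solve-∀

  sign-self : ∀ x → sign x x ≡ 0ℤ
  sign-self x = ℤ.+-inverseʳ (+ (if toℕ x ℕ.<ᵇ toℕ x then 1 else 0))

  headSign : Fin N → List (Fin N) → ℤ
  headSign x []      = 0ℤ
  headSign x (y ∷ _) = sign x y

  headsSign : List (Fin N) → List (Fin N) → ℤ
  headsSign []      q = 0ℤ
  headsSign (x ∷ _) q = headSign x q

  headsSign-antisym : ∀ p q → headsSign p q ≡ - headsSign q p
  headsSign-antisym []      []      = refl
  headsSign-antisym []      (y ∷ q) = refl
  headsSign-antisym (x ∷ p) []      = refl
  headsSign-antisym (x ∷ p) (y ∷ q) = sign-antisym x y

  ascMinusDescℤ : List (Fin N) → ℤ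
  ascMinusDescℤ w = + ascents w - + descents w

  ascMinusDescℤ-∷ : ∀ x w → ascMinusDescℤ (x ∷ w) ≡ headSign x w + ascMinusDescℤ w
  ascMinusDescℤ-∷ x []      = refl
  ascMinusDescℤ-∷ x (y ∷ w) = begin
    + (asc ℕ.+ ascents (y ∷ w)) - + (desc ℕ.+ descents (y ∷ w))
      ≡⟨ cong₂ _-_ (ℤ.pos-+ asc (ascents (y ∷ w))) (ℤ.pos-+ desc (descents (y ∷ w))) ⟩
    (+ asc + + ascents (y ∷ w)) - (+ desc + + descents (y ∷ w))
      ≡⟨ regroup (+ asc) (+ ascents (y ∷ w)) (+ desc) (+ descents (y ∷ w)) ⟩
    sign x y + ascMinusDescℤ (y ∷ w) ∎
    where
    open ≡-Reasoning
    asc  = if toℕ x ℕ.<ᵇ toℕ y then 1 else 0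
    desc = if toℕ y ℕ.<ᵇ toℕ x then 1 else 0
    regroup : ∀ (p q r s : ℤ) → (p + q) - (r + s) ≡ (p - r) + (q - s)
    regroup = solve-∀

  -- Once the top card x of packet j is dealt, the pair x forms with the top of packet k is internal to
  -- packet j if k = j, and is the cross pair of the tops of packets j and k otherwise.
  ascMinusDescℤ-dropTopAt : ∀ (ps : List (List (Fin N))) j {x r} → packet ps j ≡ x ∷ r → ∀ k →
    headSign x (packet (dropTopAt j ps) k) + ascMinusDescℤ (packet (dropTopAt j ps) k)
      ≡ ascMinusDescℤ (packet ps k) + headsSign (x ∷ r) (packet ps k)
  ascMinusDescℤ-dropTopAt ps j {x} {r} P[j] k with j ℕ.≟ k
  ... | yes refl rewrite packet-dropTopAt-≡ j ps | P[j] =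
    trans (sym (ascMinusDescℤ-∷ x r))
          (trans (sym (ℤ.+-identityʳ _)) (cong (_+_ (ascMinusDescℤ (x ∷ r))) (sym (sign-self x))))
  ... | no j≢k rewrite packet-dropTopAt-≢ j ps k j≢k = ℤ.+-comm (headSign x (packet ps k)) _

  ∑-headsSign-cancel : ∀ a (P : ℕ → List (Fin N)) c →
    ∑[ j < a ] ∑[ k < a ] (headsSign (P (toℕ j)) (P (toℕ k)) * + multinomial (decAt (toℕ k) (decAt (toℕ j) c))) ≡ 0ℤ
  ∑-headsSign-cancel a P c = ∑-antisym a _ λ j k → trans
    (cong₂ _*_ (headsSign-antisym (P (toℕ j)) (P (toℕ k))) (cong (λ d → + multinomial d) (decAt-comm (toℕ k) (toℕ j) c)))
    (sym (ℤ.neg-distribˡ-* (headsSign (P (toℕ k)) (P (toℕ j))) _))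

  ∑-within-packet : ∀ a c k (p : List (Fin N)) → length c ≡ a → nth c k ≡ length p →
    ∑[ j < a ] ifNonZero (nth c (toℕ j)) (ascMinusDescℤ p * + multinomial (decAt k (decAt (toℕ j) c)))
      ≡ ascMinusDescℤ p * + multinomial (decAt k c)
  ∑-within-packet a c k p lc c[k] = begin
    ∑[ j < a ] ifNonZero (nth c (toℕ j)) (ascMinusDescℤ p * D (toℕ j))
      ≡⟨ sum-cong-≗ {a} (λ j → ifNonZero-*ˡ (nth c (toℕ j)) (ascMinusDescℤ p) (D (toℕ j))) ⟩
    ∑[ j < a ] (ascMinusDescℤ p * ifNonZero (nth c (toℕ j)) (D (toℕ j)))
      ≡⟨ *-distribˡ-sum {a} (ascMinusDescℤ p) (λ j → ifNonZero (nth c (toℕ j)) (D (toℕ j))) ⟨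
    ascMinusDescℤ p * ∑[ j < a ] ifNonZero (nth c (toℕ j)) (D (toℕ j))
      ≡⟨ long-packet p c[k] ⟩
    ascMinusDescℤ p * + multinomial (decAt k c) ∎
    where
    open ≡-Reasoning
    D : ℕ → ℤ
    D j = + multinomial (decAt k (decAt j c))
    long-packet : ∀ p → nth c k ≡ length p →
      ascMinusDescℤ p * ∑[ j < a ] ifNonZero (nth c (toℕ j)) (D (toℕ j)) ≡ ascMinusDescℤ p * + multinomial (decAt k c)
    long-packet []          _    = refl
    long-packet (x ∷ [])    _    = refl
    long-packet (x ∷ y ∷ p) c[k] =
      cong (ascMinusDescℤ (x ∷ y ∷ p) *_) (multinomial-rec-decAt a c k lc (subst (2 ≤_) (sym c[k]) (s≤s (s≤s z≤n))))

  ∑-headSign-interleave : ∀ a (ps : List (List (Fin N))) x → length ps ≡ a →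
    ∑[ L ∈ interleavings a (sizes ps) ] headSign x (interleave ps L) ≡ packetTotal (headSign x) a ps
  ∑-headSign-interleave a ps x lp = by-size (sum (sizes ps)) refl
    where
    lc = trans (length-map length ps) lp
    by-size : ∀ m → sum (sizes ps) ≡ m →
      ∑[ L ∈ interleavings a (sizes ps) ] headSign x (interleave ps L) ≡ packetTotal (headSign x) a ps
    by-size zero Σc =
      trans (∑ᴸ-interleavings-[] a (sizes ps) _ lc Σc) (sym (packetTotal-empty (headSign x) a ps refl Σc))
    by-size (suc m) Σc = trans (∑ᴸ-interleavings-∷ a (sizes ps) _ lc Σc) (sum-cong-≗ {a} (λ k → first-card (toℕ k)))
      where
      first-card : ∀ k →
        ifNonZero (nth (sizes ps) k) (∑[ L ∈ interleavings a (decAt k (sizes ps)) ] headSign x (interleave ps (k ∷ L)))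
          ≡ headSign x (packet ps k) * + multinomial (decAt k (sizes ps))
      first-card k rewrite nth-sizes ps k with packet ps k in P[k]
      ... | []    = refl
      ... | y ∷ r = begin
        ∑[ L ∈ interleavings a (decAt k (sizes ps)) ] headSign x (interleave ps (k ∷ L))
          ≡⟨ ∑ᴸ-cong (interleavings a (decAt k (sizes ps))) (λ L → cong (headSign x) (interleave-∷ ps k L P[k])) ⟩
        ∑[ L ∈ interleavings a (decAt k (sizes ps)) ] sign x y
          ≡⟨ ∑ᴸ-const (interleavings a (decAt k (sizes ps))) (sign x y) ⟩
        sign x y * + length (interleavings a (decAt k (sizes ps)))
          ≡⟨ cong (λ n → sign x y * + n)
                  (length-interleavings a (decAt k (sizes ps)) (trans (length-decAt k (sizes ps)) lc)) ⟩
        sign x y * + multinomial (decAt k (sizes ps)) ∎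
        where open ≡-Reasoning

  ∑-interleave-dealt : ∀ a (ps : List (List (Fin N))) j {x r} → length ps ≡ a → packet ps j ≡ x ∷ r →
    ∑[ L ∈ interleavings a (sizes (dropTopAt j ps)) ] ascMinusDescℤ (interleave (dropTopAt j ps) L)
      ≡ packetTotal ascMinusDescℤ a (dropTopAt j ps) →
    ∑[ L ∈ interleavings a (decAt j (sizes ps)) ] ascMinusDescℤ (interleave ps (j ∷ L))
      ≡ ∑[ k < a ] (ascMinusDescℤ (packet ps (toℕ k)) * + multinomial (decAt (toℕ k) (decAt j (sizes ps))))
        + ∑[ k < a ] (headsSign (x ∷ r) (packet ps (toℕ k)) * + multinomial (decAt (toℕ k) (decAt j (sizes ps))))
  ∑-interleave-dealt a ps j {x} {r} lp P[j] dealt = begin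
    ∑[ L ∈ interleavings a (decAt j (sizes ps)) ] ascMinusDescℤ (interleave ps (j ∷ L))
      ≡⟨ ∑ᴸ-cong (interleavings a (decAt j (sizes ps))) (λ L → trans (cong ascMinusDescℤ (interleave-∷ ps j L P[j]))
                                                                   (ascMinusDescℤ-∷ x (interleave qs L))) ⟩
    ∑[ L ∈ interleavings a (decAt j (sizes ps)) ] (headSign x (interleave qs L) + ascMinusDescℤ (interleave qs L))
      ≡⟨ cong (λ d → ∑[ L ∈ interleavings a d ] (headSign x (interleave qs L) + ascMinusDescℤ (interleave qs L)))
              (sym (sizes-dropTopAt j ps)) ⟩
    ∑[ L ∈ interleavings a (sizes qs) ] (headSign x (interleave qs L) + ascMinusDescℤ (interleave qs L))
      ≡⟨ ∑ᴸ-distrib-+ (interleavings a (sizes qs)) _ _ ⟩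
    ∑[ L ∈ interleavings a (sizes qs) ] headSign x (interleave qs L)
      + ∑[ L ∈ interleavings a (sizes qs) ] ascMinusDescℤ (interleave qs L)
      ≡⟨ cong₂ _+_ (∑-headSign-interleave a qs x (trans (length-dropTopAt j ps) lp)) dealt ⟩
    packetTotal (headSign x) a qs + packetTotal ascMinusDescℤ a qs
      ≡⟨ ∑-distrib-+ (λ k → headSign x (Q k) * D′ k) (λ k → ascMinusDescℤ (Q k) * D′ k) ⟨
    ∑[ k < a ] (headSign x (Q k) * D′ k + ascMinusDescℤ (Q k) * D′ k)
      ≡⟨ sum-cong-≗ {a} regroup ⟩
    ∑[ k < a ] (ascMinusDescℤ (P k) * D k + headsSign (x ∷ r) (P k) * D k)
      ≡⟨ ∑-distrib-+ (λ k → ascMinusDescℤ (P k) * D k) (λ k → headsSign (x ∷ r) (P k) * D k) ⟩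
    ∑[ k < a ] (ascMinusDescℤ (P k) * D k) + ∑[ k < a ] (headsSign (x ∷ r) (P k) * D k) ∎
    where
    open ≡-Reasoning
    qs = dropTopAt j ps
    P Q : Fin a → List (Fin N)
    P k = packet ps (toℕ k)
    Q k = packet qs (toℕ k)
    D D′ : Fin a → ℤ
    D k  = + multinomial (decAt (toℕ k) (decAt j (sizes ps)))
    D′ k = + multinomial (decAt (toℕ k) (sizes qs))
    regroup : ∀ k → headSign x (Q k) * D′ k + ascMinusDescℤ (Q k) * D′ k
                  ≡ ascMinusDescℤ (P k) * D k + headsSign (x ∷ r) (P k) * D k
    regroup k = begin
      headSign x (Q k) * D′ k + ascMinusDescℤ (Q k) * D′ k
        ≡⟨ ℤ.*-distribʳ-+ (D′ k) (headSign x (Q k)) _ ⟨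
      (headSign x (Q k) + ascMinusDescℤ (Q k)) * D′ k
        ≡⟨ cong₂ _*_ (ascMinusDescℤ-dropTopAt ps j P[j] (toℕ k))
                     (cong (λ d → + multinomial (decAt (toℕ k) d)) (sizes-dropTopAt j ps)) ⟩
      (ascMinusDescℤ (P k) + headsSign (x ∷ r) (P k)) * D k
        ≡⟨ ℤ.*-distribʳ-+ (D k) (ascMinusDescℤ (P k)) _ ⟩
      ascMinusDescℤ (P k) * D k + headsSign (x ∷ r) (P k) * D k ∎

  ∑-ascMinusDesc-interleave : ∀ a (ps : List (List (Fin N))) → length ps ≡ a →
    ∑[ L ∈ interleavings a (sizes ps) ] ascMinusDescℤ (interleave ps L) ≡ packetTotal ascMinusDescℤ a ps
  ∑-ascMinusDesc-interleave a ps lp = by-size (sum (sizes ps)) ps lp refl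
    where
    by-size : ∀ m (ps : List (List (Fin N))) → length ps ≡ a → sum (sizes ps) ≡ m →
      ∑[ L ∈ interleavings a (sizes ps) ] ascMinusDescℤ (interleave ps L) ≡ packetTotal ascMinusDescℤ a ps
    by-size zero ps lp Σc = trans (∑ᴸ-interleavings-[] a (sizes ps) _ (trans (length-map length ps) lp) Σc)
                                  (sym (packetTotal-empty ascMinusDescℤ a ps refl Σc))
    by-size (suc m) ps lp Σc = begin
      ∑[ L ∈ interleavings a c ] ascMinusDescℤ (interleave ps L)
        ≡⟨ ∑ᴸ-interleavings-∷ a c _ lc Σc ⟩
      ∑[ j < a ] ifNonZero (nth c (toℕ j))
                   (∑[ L ∈ interleavings a (decAt (toℕ j) c) ] ascMinusDescℤ (interleave ps (toℕ j ∷ L)))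
        ≡⟨ sum-cong-≗ {a} (λ j → first-card (toℕ j)) ⟩
      ∑[ j < a ] (Within j + Across j)
        ≡⟨ ∑-distrib-+ Within Across ⟩
      ∑[ j < a ] Within j + ∑[ j < a ] Across j
        ≡⟨ cong (_+_ (∑[ j < a ] Within j)) (∑-headsSign-cancel a P c) ⟩
      ∑[ j < a ] Within j + 0ℤ
        ≡⟨ ℤ.+-identityʳ _ ⟩
      ∑[ j < a ] ∑[ k < a ] ifNonZero (nth c (toℕ j)) (f k * D (toℕ j) (toℕ k))
        ≡⟨ ∑-comm {a} {a} (λ j k → ifNonZero (nth c (toℕ j)) (f k * D (toℕ j) (toℕ k))) ⟩
      ∑[ k < a ] ∑[ j < a ] ifNonZero (nth c (toℕ j)) (f k * D (toℕ j) (toℕ k))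
        ≡⟨ sum-cong-≗ {a} (λ k → ∑-within-packet a c (toℕ k) (P (toℕ k)) lc (nth-sizes ps (toℕ k))) ⟩
      packetTotal ascMinusDescℤ a ps ∎
      where
      open ≡-Reasoning
      c = sizes ps
      lc = trans (length-map length ps) lp
      P = packet ps
      f : Fin a → ℤ
      f k = ascMinusDescℤ (P (toℕ k))
      D : ℕ → ℕ → ℤ
      D j k = + multinomial (decAt k (decAt j c))
      Within Across : Fin a → ℤ
      Within j = ∑[ k < a ] ifNonZero (nth c (toℕ j)) (f k * D (toℕ j) (toℕ k))
      Across j = ∑[ k < a ] (headsSign (P (toℕ j)) (P (toℕ k)) * D (toℕ j) (toℕ k))

      first-card : ∀ j →
        ifNonZero (nth c j) (∑[ L ∈ interleavings a (decAt j c) ] ascMinusDescℤ (interleave ps (j ∷ L)))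
          ≡ ∑[ k < a ] ifNonZero (nth c j) (f k * D j (toℕ k)) + ∑[ k < a ] (headsSign (P j) (P (toℕ k)) * D j (toℕ k))
      first-card j rewrite nth-sizes ps j with P j in P[j]
      ... | []    = sym (cong₂ _+_ (sum-replicate-zero a) (sum-replicate-zero a))
      ... | x ∷ r = ∑-interleave-dealt a ps j lp P[j]
        (by-size m (dropTopAt j ps) (trans (length-dropTopAt j ps) lp)
          (trans (cong sum (sizes-dropTopAt j ps))
                 (ℕ.suc-injective (trans (sym (sum-decAt j c (trans (nth-sizes ps j) (cong length P[j])))) Σc))))

-- Cutting the deck

comps-sound : ∀ a n → All (λ c → length c ≡ a × sum c ≡ n) (comps a n)
comps-sound zero    zero    = (refl , refl) ∷ []
comps-sound zero    (suc n) = []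
comps-sound (suc a) n = concat⁺ (map⁺ (All.map (λ {k} k<1+n → map⁺ (All.map
  (λ (lc , sc) → cong suc lc , trans (cong (k ℕ.+_) sc) (ℕ.m+[n∸m]≡n (ℕ.≤-pred k<1+n)))
  (comps-sound a (n ∸ k)))) (all-upTo (suc n))))

∑ᴸ-comps-suc : ∀ a n (H : List ℕ → ℤ) →
  ∑ᴸ (comps (suc a) n) H ≡ ∑[ k < suc n ] ∑[ c ∈ comps a (n ∸ toℕ k) ] H (toℕ k ∷ c)
∑ᴸ-comps-suc a n H = begin
  ∑ᴸ (concatMap (λ k → map (k ∷_) (comps a (n ∸ k))) (upTo (suc n))) H
    ≡⟨ ∑ᴸ-concatMap (λ k → map (k ∷_) (comps a (n ∸ k))) (upTo (suc n)) H ⟩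
  ∑[ k ∈ upTo (suc n) ] ∑ᴸ (map (k ∷_) (comps a (n ∸ k))) H
    ≡⟨ ∑ᴸ-cong (upTo (suc n)) (λ k → ∑ᴸ-map (k ∷_) (comps a (n ∸ k)) H) ⟩
  ∑[ k ∈ upTo (suc n) ] ∑[ c ∈ comps a (n ∸ k) ] H (k ∷ c)
    ≡⟨ ∑ᴸ-upTo (suc n) (λ k → ∑[ c ∈ comps a (n ∸ k) ] H (k ∷ c)) ⟩
  ∑[ k < suc n ] ∑[ c ∈ comps a (n ∸ toℕ k) ] H (toℕ k ∷ c) ∎
  where open ≡-Reasoning

∑-multinomial-comps : ∀ a m → ∑[ c ∈ comps a m ] (+ multinomial c) ≡ + (a ℕ.^ m)
∑-multinomial-comps zero    zero    = refl
∑-multinomial-comps zero    (suc m) = refl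
∑-multinomial-comps (suc a) m = begin
  ∑[ c ∈ comps (suc a) m ] (+ multinomial c)
    ≡⟨ ∑ᴸ-comps-suc a m (λ c → + multinomial c) ⟩
  ∑[ k < suc m ] ∑[ c ∈ comps a (m ∸ toℕ k) ] (+ multinomial (toℕ k ∷ c))
    ≡⟨ sum-cong-≗ {suc m} (λ k → first-part (toℕ k) (ℕ.≤-pred (toℕ<n k))) ⟩
  ∑[ k < suc m ] (+ (m C toℕ k) * + (a ℕ.^ (m ∸ toℕ k)))
    ≡⟨ binomial m a ⟩
  + (suc a ℕ.^ m) ∎
  where
  open ≡-Reasoning
  first-part : ∀ k → k ≤ m → ∑[ c ∈ comps a (m ∸ k) ] (+ multinomial (k ∷ c)) ≡ + (m C k) * + (a ℕ.^ (m ∸ k))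
  first-part k k≤m = begin
    ∑[ c ∈ comps a (m ∸ k) ] (+ multinomial (k ∷ c))
      ≡⟨ ∑ᴸ-cong-All (comps-sound a (m ∸ k)) (λ c (_ , sc) →
           trans (cong (λ s → + (((k ℕ.+ s) C k) ℕ.* multinomial c)) sc)
                 (trans (cong (λ n → + ((n C k) ℕ.* multinomial c)) (ℕ.m+[n∸m]≡n k≤m)) (ℤ.pos-* (m C k) _))) ⟩
    ∑[ c ∈ comps a (m ∸ k) ] (+ (m C k) * + multinomial c)
      ≡⟨ *-distribˡ-∑ᴸ (+ (m C k)) (comps a (m ∸ k)) (λ c → + multinomial c) ⟨
    + (m C k) * ∑[ c ∈ comps a (m ∸ k) ] (+ multinomial c)
      ≡⟨ cong (_*_ (+ (m C k))) (∑-multinomial-comps a (m ∸ k)) ⟩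
    + (m C k) * + (a ℕ.^ (m ∸ k)) ∎

module _ {N : ℕ} where

  headSign-take : ∀ x i (w : List (Fin N)) → headSign x (take (suc i) w) ≡ headSign x w
  headSign-take x i []      = refl
  headSign-take x i (y ∷ w) = refl

  ascMinusDescℤ-take-drop : ∀ i (u : List (Fin N)) → i < length u →
    ascMinusDescℤ (take (suc i) u) + ascMinusDescℤ (drop i u) ≡ ascMinusDescℤ u
  ascMinusDescℤ-take-drop zero    (x ∷ w) _         = ℤ.+-identityˡ _
  ascMinusDescℤ-take-drop (suc i) (x ∷ w) (s≤s i<n) = begin
    ascMinusDescℤ (x ∷ take (suc i) w) + ascMinusDescℤ (drop i w)
      ≡⟨ cong (_+ ascMinusDescℤ (drop i w)) (ascMinusDescℤ-∷ x (take (suc i) w)) ⟩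
    (headSign x (take (suc i) w) + ascMinusDescℤ (take (suc i) w)) + ascMinusDescℤ (drop i w)
      ≡⟨ ℤ.+-assoc (headSign x (take (suc i) w)) _ _ ⟩
    headSign x (take (suc i) w) + (ascMinusDescℤ (take (suc i) w) + ascMinusDescℤ (drop i w))
      ≡⟨ cong₂ _+_ (headSign-take x i w) (ascMinusDescℤ-take-drop i w i<n) ⟩
    headSign x w + ascMinusDescℤ w
      ≡⟨ ascMinusDescℤ-∷ x w ⟨
    ascMinusDescℤ (x ∷ w) ∎
    where open ≡-Reasoning

  cutTotal : ℕ → List (Fin N) → List ℕ → ℤ
  cutTotal a u c = ∑[ j < a ] (ascMinusDescℤ (packet (cut c u) (toℕ j)) * + multinomial (decAt (toℕ j) c))

  -- C(n − 1, k − 1) and C(n − 1, k), in the form in which they arise from multinomial ((k ∸ 1) ∷ c) and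
  -- multinomial (k ∷ c′) when sum c = n − k; they differ from these binomials only where the term they
  -- multiply vanishes.
  firstCoeff laterCoeff : ℕ → ℕ → ℕ
  firstCoeff n k = ((k ∸ 1) ℕ.+ (n ∸ k)) C (k ∸ 1)
  laterCoeff n k = (k ℕ.+ ((n ∸ k) ∸ 1)) C k

  firstPacketTerm laterPacketsTerm : ℕ → ℕ → List (Fin N) → ℕ → ℤ
  firstPacketTerm  a n u k = ascMinusDescℤ (take k u) * (+ firstCoeff n k * + (a ℕ.^ (n ∸ k)))
  laterPacketsTerm a n u k = + laterCoeff n k * (+ (a ℕ.^ ((n ∸ k) ∸ 1)) * ascMinusDescℤ (drop k u))

  cutTotal-∷ : ∀ a n k c (u : List (Fin N)) → length u ≡ n → sum c ≡ n ∸ k →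
    cutTotal (suc a) u (k ∷ c)
      ≡ ascMinusDescℤ (take k u) * (+ firstCoeff n k * + multinomial c) + + laterCoeff n k * cutTotal a (drop k u) c
  cutTotal-∷ a n k c u refl sc = cong₂ _+_
    (cong (ascMinusDescℤ (take k u) *_)
          (trans (cong (λ s → + ((((k ∸ 1) ℕ.+ s) C (k ∸ 1)) ℕ.* multinomial c)) sc) (ℤ.pos-* (firstCoeff n k) _)))
    (trans (sum-cong-≗ {a} (λ j → later (toℕ j))) (sym (*-distribˡ-sum {a} (+ laterCoeff n k) _)))
    where
    Q : ℕ → List (Fin N)
    Q j = packet (cut c (drop k u)) j
    ∣Q∣ : ∀ j → length (Q j) ≡ nth c j
    ∣Q∣ j = length-packet-cut c (drop k u) j (trans sc (sym (length-drop k u)))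
    later : ∀ j → ascMinusDescℤ (Q j) * + multinomial (k ∷ decAt j c)
                ≡ + laterCoeff n k * (ascMinusDescℤ (Q j) * + multinomial (decAt j c))
    later j with nth c j in c[j] | Q j | ∣Q∣ j
    ... | zero  | [] | _ = sym (ℤ.*-zeroʳ (+ laterCoeff n k))
    ... | suc r | q  | _ = begin
      ascMinusDescℤ q * + (((k ℕ.+ sum (decAt j c)) C k) ℕ.* multinomial (decAt j c))
        ≡⟨ cong (λ s → ascMinusDescℤ q * + (((k ℕ.+ s) C k) ℕ.* multinomial (decAt j c)))
                (cong (_∸ 1) (trans (sym (sum-decAt j c c[j])) sc)) ⟩
      ascMinusDescℤ q * + (laterCoeff n k ℕ.* multinomial (decAt j c))
        ≡⟨ cong (ascMinusDescℤ q *_) (ℤ.pos-* (laterCoeff n k) _) ⟩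
      ascMinusDescℤ q * (+ laterCoeff n k * + multinomial (decAt j c))
        ≡⟨ swap (ascMinusDescℤ q) (+ laterCoeff n k) _ ⟩
      + laterCoeff n k * (ascMinusDescℤ q * + multinomial (decAt j c)) ∎
      where
      open ≡-Reasoning
      swap : ∀ (x y z : ℤ) → x * (y * z) ≡ y * (x * z)
      swap = solve-∀

  laterPacketsTerm-last : ∀ a n (u : List (Fin N)) → length u ≡ n → laterPacketsTerm a n u n ≡ 0ℤ
  laterPacketsTerm-last a n u lu rewrite drop-all n u (ℕ.≤-reflexive lu) =
    trans (cong (+ laterCoeff n n *_) (ℤ.*-zeroʳ (+ (a ℕ.^ ((n ∸ n) ∸ 1))))) (ℤ.*-zeroʳ (+ laterCoeff n n))

  packetTerms-overlap : ∀ a n (u : List (Fin N)) i → length u ≡ suc n → i ≤ n →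
    firstPacketTerm a (suc n) u (suc i) + laterPacketsTerm a (suc n) u i ≡ ascMinusDescℤ u * (+ (n C i) * + (a ℕ.^ (n ∸ i)))
  packetTerms-overlap a n u i lu i≤n = begin
    ascMinusDescℤ (take (suc i) u) * (+ ((i ℕ.+ (n ∸ i)) C i) * + (a ℕ.^ (n ∸ i)))
      + + ((i ℕ.+ ((suc n ∸ i) ∸ 1)) C i) * (+ (a ℕ.^ ((suc n ∸ i) ∸ 1)) * ascMinusDescℤ (drop i u))
      ≡⟨ cong (λ e → ascMinusDescℤ (take (suc i) u) * (+ ((i ℕ.+ (n ∸ i)) C i) * + (a ℕ.^ (n ∸ i)))
                       + + ((i ℕ.+ e) C i) * (+ (a ℕ.^ e) * ascMinusDescℤ (drop i u)))
              (cong (_∸ 1) (ℕ.+-∸-assoc 1 i≤n)) ⟩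
    ascMinusDescℤ (take (suc i) u) * B + + ((i ℕ.+ (n ∸ i)) C i) * (+ (a ℕ.^ (n ∸ i)) * ascMinusDescℤ (drop i u))
      ≡⟨ factor (ascMinusDescℤ (take (suc i) u)) (+ ((i ℕ.+ (n ∸ i)) C i)) (+ (a ℕ.^ (n ∸ i))) _ ⟩
    (ascMinusDescℤ (take (suc i) u) + ascMinusDescℤ (drop i u)) * B
      ≡⟨ cong₂ _*_ (ascMinusDescℤ-take-drop i u (subst (i <_) (sym lu) (s≤s i≤n)))
                   (cong (λ m → + (m C i) * + (a ℕ.^ (n ∸ i))) (ℕ.m+[n∸m]≡n i≤n)) ⟩
    ascMinusDescℤ u * (+ (n C i) * + (a ℕ.^ (n ∸ i))) ∎
    where
    open ≡-Reasoning
    B = + ((i ℕ.+ (n ∸ i)) C i) * + (a ℕ.^ (n ∸ i))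
    factor : ∀ (x y z w : ℤ) → x * (y * z) + y * (z * w) ≡ (x + w) * (y * z)
    factor = solve-∀

  ∑-packetTerms : ∀ a n (u : List (Fin N)) → length u ≡ n →
    ∑[ k < suc n ] (firstPacketTerm a n u (toℕ k) + laterPacketsTerm a n u (toℕ k)) ≡ + (suc a ℕ.^ (n ∸ 1)) * ascMinusDescℤ u
  ∑-packetTerms a zero    [] refl = trans (ℤ.+-identityʳ _) (ℤ.*-zeroʳ (+ laterCoeff 0 0))
  ∑-packetTerms a (suc n) u lu = begin
    ∑[ k < suc (suc n) ] (T₁ (toℕ k) + T₂ (toℕ k))
      ≡⟨ ∑-distrib-+ {suc (suc n)} (T₁ ∘ toℕ) (T₂ ∘ toℕ) ⟩
    (0ℤ + ∑[ i < suc n ] T₁ (suc (toℕ i))) + ∑[ k < suc (suc n) ] T₂ (toℕ k)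
      ≡⟨ cong₂ _+_ (ℤ.+-identityˡ (∑[ i < suc n ] T₁ (suc (toℕ i)))) (∑-last (suc n) T₂) ⟩
    ∑[ i < suc n ] T₁ (suc (toℕ i)) + (∑[ i < suc n ] T₂ (toℕ i) + T₂ (suc n))
      ≡⟨ cong (λ t → ∑[ i < suc n ] T₁ (suc (toℕ i)) + (∑[ i < suc n ] T₂ (toℕ i) + t))
              (laterPacketsTerm-last a (suc n) u lu) ⟩
    ∑[ i < suc n ] T₁ (suc (toℕ i)) + (∑[ i < suc n ] T₂ (toℕ i) + 0ℤ)
      ≡⟨ cong (_+_ (∑[ i < suc n ] T₁ (suc (toℕ i)))) (ℤ.+-identityʳ _) ⟩
    ∑[ i < suc n ] T₁ (suc (toℕ i)) + ∑[ i < suc n ] T₂ (toℕ i)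
      ≡⟨ ∑-distrib-+ {suc n} (λ i → T₁ (suc (toℕ i))) (T₂ ∘ toℕ) ⟨
    ∑[ i < suc n ] (T₁ (suc (toℕ i)) + T₂ (toℕ i))
      ≡⟨ sum-cong-≗ {suc n} (λ i → packetTerms-overlap a n u (toℕ i) lu (ℕ.≤-pred (toℕ<n i))) ⟩
    ∑[ i < suc n ] (ascMinusDescℤ u * (+ (n C toℕ i) * + (a ℕ.^ (n ∸ toℕ i))))
      ≡⟨ *-distribˡ-sum {suc n} (ascMinusDescℤ u) (λ i → + (n C toℕ i) * + (a ℕ.^ (n ∸ toℕ i))) ⟨
    ascMinusDescℤ u * ∑[ i < suc n ] (+ (n C toℕ i) * + (a ℕ.^ (n ∸ toℕ i)))
      ≡⟨ cong (ascMinusDescℤ u *_) (binomial n a) ⟩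
    ascMinusDescℤ u * + (suc a ℕ.^ n)
      ≡⟨ ℤ.*-comm (ascMinusDescℤ u) _ ⟩
    + (suc a ℕ.^ n) * ascMinusDescℤ u ∎
    where
    open ≡-Reasoning
    T₁ T₂ : ℕ → ℤ
    T₁ = firstPacketTerm a (suc n) u
    T₂ = laterPacketsTerm a (suc n) u

  ∑-cutTotal-∷ : ∀ a n k (u : List (Fin N)) → length u ≡ n →
    ∑[ c ∈ comps a (n ∸ k) ] cutTotal a (drop k u) c ≡ + (a ℕ.^ ((n ∸ k) ∸ 1)) * ascMinusDescℤ (drop k u) →
    ∑[ c ∈ comps a (n ∸ k) ] cutTotal (suc a) u (k ∷ c) ≡ firstPacketTerm a n u k + laterPacketsTerm a n u k
  ∑-cutTotal-∷ a n k u lu later-packets = begin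
    ∑[ c ∈ comps a (n ∸ k) ] cutTotal (suc a) u (k ∷ c)
      ≡⟨ ∑ᴸ-cong-All (comps-sound a (n ∸ k)) (λ c (_ , sc) → cutTotal-∷ a n k c u lu sc) ⟩
    ∑[ c ∈ comps a (n ∸ k) ] (f₁ * (+ firstCoeff n k * + multinomial c) + + laterCoeff n k * cutTotal a (drop k u) c)
      ≡⟨ ∑ᴸ-distrib-+ (comps a (n ∸ k)) _ _ ⟩
    ∑[ c ∈ comps a (n ∸ k) ] (f₁ * (+ firstCoeff n k * + multinomial c))
      + ∑[ c ∈ comps a (n ∸ k) ] (+ laterCoeff n k * cutTotal a (drop k u) c)
      ≡⟨ cong₂ _+_ (*-distribˡ-∑ᴸ f₁ (comps a (n ∸ k)) _) (*-distribˡ-∑ᴸ (+ laterCoeff n k) (comps a (n ∸ k)) _) ⟨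
    f₁ * ∑[ c ∈ comps a (n ∸ k) ] (+ firstCoeff n k * + multinomial c)
      + + laterCoeff n k * ∑[ c ∈ comps a (n ∸ k) ] cutTotal a (drop k u) c
      ≡⟨ cong₂ (λ x y → f₁ * x + + laterCoeff n k * y)
               (trans (sym (*-distribˡ-∑ᴸ (+ firstCoeff n k) (comps a (n ∸ k)) _))
                      (cong (_*_ (+ firstCoeff n k)) (∑-multinomial-comps a (n ∸ k))))
               later-packets ⟩
    firstPacketTerm a n u k + laterPacketsTerm a n u k ∎
    where
    open ≡-Reasoning
    f₁ = ascMinusDescℤ (take k u)

  ∑-cutTotal : ∀ a n (u : List (Fin N)) → length u ≡ n →
    ∑[ c ∈ comps a n ] cutTotal a u c ≡ + (a ℕ.^ (n ∸ 1)) * ascMinusDescℤ u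
  ∑-cutTotal zero    zero          []       refl = refl
  ∑-cutTotal zero    (suc zero)    (x ∷ []) refl = refl
  ∑-cutTotal zero    (suc (suc n)) u        _    = refl
  ∑-cutTotal (suc a) n u lu = begin
    ∑[ c ∈ comps (suc a) n ] cutTotal (suc a) u c
      ≡⟨ ∑ᴸ-comps-suc a n (cutTotal (suc a) u) ⟩
    ∑[ k < suc n ] ∑[ c ∈ comps a (n ∸ toℕ k) ] cutTotal (suc a) u (toℕ k ∷ c)
      ≡⟨ sum-cong-≗ {suc n} (λ k → ∑-cutTotal-∷ a n (toℕ k) u lu (∑-cutTotal a (n ∸ toℕ k) (drop (toℕ k) u)
                                      (trans (length-drop (toℕ k) u) (cong (_∸ toℕ k) lu)))) ⟩
    ∑[ k < suc n ] (firstPacketTerm a n u (toℕ k) + laterPacketsTerm a n u (toℕ k))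
      ≡⟨ ∑-packetTerms a n u lu ⟩
    + (suc a ℕ.^ (n ∸ 1)) * ascMinusDescℤ u ∎
    where open ≡-Reasoning

⟦_⟧ : Bool → ℤ
⟦ b ⟧ = if b then + 1 else 0ℤ

∑ᴸ-tabulate : {A : Set} → ∀ n (f : Fin n → A) (h : A → ℤ) → ∑ᴸ (tabulate f) h ≡ ∑[ i < n ] h (f i)
∑ᴸ-tabulate zero    f h = refl
∑ᴸ-tabulate (suc n) f h = cong (_+_ (h (f Fin.zero))) (∑ᴸ-tabulate n (f ∘ Fin.suc) h)

∑-⟦≟⟧ : ∀ n (y : Fin n) → ∑[ x < n ] ⟦ ⌊ y ≟F x ⌋ ⟧ ≡ + 1
∑-⟦≟⟧ (suc n) Fin.zero    = cong (_+_ (+ 1)) (sum-replicate-zero n)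
∑-⟦≟⟧ (suc n) (Fin.suc y) = trans (ℤ.+-identityˡ _)
  (trans (sum-cong-≗ {n} (λ x → cong ⟦_⟧ (⌊⌋-map′ (cong Fin.suc) suc-injective (y ≟F x)))) (∑-⟦≟⟧ n y))

∑-vec-lookup : ∀ n (ν : Vec ℕ n) → ∑[ i < n ] (+ lookup ν i) ≡ + Vec.sum ν
∑-vec-lookup zero    Vec.[]       = refl
∑-vec-lookup (suc n) (x Vec.∷ ν) = trans (cong (_+_ (+ x)) (∑-vec-lookup n ν)) (sym (ℤ.pos-+ x (Vec.sum ν)))

module _ {N : ℕ} where

  ⟦≡-dec-∷⟧ : ∀ y (w : List (Fin N)) x v →
    ⟦ ⌊ ≡-dec _≟F_ (y ∷ w) (x ∷ v) ⌋ ⟧ ≡ (if ⌊ y ≟F x ⌋ then ⟦ ⌊ ≡-dec _≟F_ w v ⌋ ⟧ else 0ℤ)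
  ⟦≡-dec-∷⟧ y w x v with y ≟F x | ≡-dec _≟F_ w v
  ... | yes refl | yes _ = refl
  ... | yes refl | no _  = refl
  ... | no _     | _     = refl

  ∑-words-⟦≟⟧ : ∀ m (w : List (Fin N)) → length w ≡ m → ∑[ v ∈ words (allFin N) m ] ⟦ ⌊ ≡-dec _≟F_ w v ⌋ ⟧ ≡ + 1
  ∑-words-⟦≟⟧ zero    []      _  = refl
  ∑-words-⟦≟⟧ (suc m) (y ∷ w) ∣w∣ = begin
    ∑ᴸ (concatMap (λ x → map (x ∷_) (words (allFin N) m)) (allFin N)) (λ v → ⟦ ⌊ ≡-dec _≟F_ (y ∷ w) v ⌋ ⟧)
      ≡⟨ ∑ᴸ-concatMap (λ x → map (x ∷_) (words (allFin N) m)) (allFin N) _ ⟩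
    ∑[ x ∈ allFin N ] ∑[ v ∈ map (x ∷_) (words (allFin N) m) ] ⟦ ⌊ ≡-dec _≟F_ (y ∷ w) v ⌋ ⟧
      ≡⟨ ∑ᴸ-cong (allFin N) (λ x → trans (∑ᴸ-map (x ∷_) (words (allFin N) m) _)
                                        (trans (∑ᴸ-cong (words (allFin N) m) (⟦≡-dec-∷⟧ y w x)) (rest ⌊ y ≟F x ⌋))) ⟩
    ∑[ x ∈ allFin N ] ⟦ ⌊ y ≟F x ⌋ ⟧
      ≡⟨ ∑ᴸ-tabulate N (λ x → x) _ ⟩
    ∑[ x < N ] ⟦ ⌊ y ≟F x ⌋ ⟧
      ≡⟨ ∑-⟦≟⟧ N y ⟩
    + 1 ∎
    where
    open ≡-Reasoning
    rest : ∀ b → ∑[ v ∈ words (allFin N) m ] (if b then ⟦ ⌊ ≡-dec _≟F_ w v ⌋ ⟧ else 0ℤ) ≡ ⟦ b ⟧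
    rest true  = ∑-words-⟦≟⟧ m w (ℕ.suc-injective ∣w∣)
    rest false = ∑ᴸ-zero (words (allFin N) m)

  countF-↭ : ∀ i {w w′ : List (Fin N)} → w ↭ w′ → countF i w ≡ countF i w′
  countF-↭ i w↭w′ = ↭-length (filter-↭ (T? ∘ (λ x → ⌊ x ≟F i ⌋)) w↭w′)

  isArrangement-↭ : ∀ (ν : Vec ℕ N) {w w′ : List (Fin N)} → w ↭ w′ → isArrangement ν w ≡ isArrangement ν w′
  isArrangement-↭ ν w↭w′ = cong and (map-cong (λ i → cong (ℕ._≡ᵇ lookup ν i) (countF-↭ i w↭w′)) (allFin N))

  countF-∷ : ∀ i x (w : List (Fin N)) → + countF i (x ∷ w) ≡ ⟦ ⌊ x ≟F i ⌋ ⟧ + + countF i w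
  countF-∷ i x w with x ≟F i
  ... | yes _ = refl
  ... | no _  = sym (ℤ.+-identityˡ _)

  length-as-counts : ∀ (w : List (Fin N)) → + length w ≡ ∑[ i < N ] (+ countF i w)
  length-as-counts []      = sym (sum-replicate-zero N)
  length-as-counts (x ∷ w) = begin
    + suc (length w)                             ≡⟨ ℤ.pos-+ 1 (length w) ⟩
    + 1 + + length w                             ≡⟨ cong₂ _+_ (sym (∑-⟦≟⟧ N x)) (length-as-counts w) ⟩
    ∑[ i < N ] ⟦ ⌊ x ≟F i ⌋ ⟧ + ∑[ i < N ] (+ countF i w)
                                                 ≡⟨ ∑-distrib-+ (λ i → ⟦ ⌊ x ≟F i ⌋ ⟧) (λ i → + countF i w) ⟨
    ∑[ i < N ] (⟦ ⌊ x ≟F i ⌋ ⟧ + + countF i w)  ≡⟨ sum-cong-≗ {N} (λ i → countF-∷ i x w) ⟨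
    ∑[ i < N ] (+ countF i (x ∷ w))             ∎
    where open ≡-Reasoning

  isArrangement⇒countF : ∀ (ν : Vec ℕ N) w → isArrangement ν w ≡ true → ∀ i → countF i w ≡ lookup ν i
  isArrangement⇒countF ν w isArr i = ℕ.≡ᵇ⇒≡ _ _
    (tabulate⁻ (all⁺ (λ j → countF j w ℕ.≡ᵇ lookup ν j) (allFin N) (Equivalence.from T-≡ isArr)) i)

  length-arrangement : ∀ (ν : Vec ℕ N) w → isArrangement ν w ≡ true → length w ≡ deckSize ν
  length-arrangement ν w isArr = ℤ.+-injective (begin
    + length w                    ≡⟨ length-as-counts w ⟩
    ∑[ i < N ] (+ countF i w)     ≡⟨ sum-cong-≗ {N} (λ i → cong +_ (isArrangement⇒countF ν w isArr i)) ⟩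
    ∑[ i < N ] (+ lookup ν i)     ≡⟨ ∑-vec-lookup N ν ⟩
    + deckSize ν                  ∎)
    where open ≡-Reasoning

  ∑-arrangements-⟦≟⟧ : ∀ (ν : Vec ℕ N) w → isArrangement ν w ≡ true →
    ∑[ v ∈ arrangements ν ] ⟦ ⌊ ≡-dec _≟F_ w v ⌋ ⟧ ≡ + 1
  ∑-arrangements-⟦≟⟧ ν w isArr = begin
    ∑[ v ∈ arrangements ν ] ⟦ ⌊ ≡-dec _≟F_ w v ⌋ ⟧
      ≡⟨ ∑ᴸ-filterᵇ (isArrangement ν) (words (allFin N) (deckSize ν)) _ ⟩
    ∑[ v ∈ words (allFin N) (deckSize ν) ] (if isArrangement ν v then ⟦ ⌊ ≡-dec _≟F_ w v ⌋ ⟧ else 0ℤ)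
      ≡⟨ ∑ᴸ-cong (words (allFin N) (deckSize ν)) (λ v → only-w v (≡-dec _≟F_ w v)) ⟩
    ∑[ v ∈ words (allFin N) (deckSize ν) ] ⟦ ⌊ ≡-dec _≟F_ w v ⌋ ⟧
      ≡⟨ ∑-words-⟦≟⟧ (deckSize ν) w (length-arrangement ν w isArr) ⟩
    + 1 ∎
    where
    open ≡-Reasoning
    only-w : ∀ v (w≟v : Dec (w ≡ v)) → (if isArrangement ν v then ⟦ ⌊ w≟v ⌋ ⟧ else 0ℤ) ≡ ⟦ ⌊ w≟v ⌋ ⟧
    only-w v (yes refl) rewrite isArr = refl
    only-w v (no _) with isArrangement ν v
    ... | true  = refl
    ... | false = refl

  #outputs : ℕ → List (Fin N) → List ℕ → List (Fin N) → ℕ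
  #outputs a u c v = length (filterᵇ (λ L → ⌊ ≡-dec _≟F_ (interleave (cut c u) L) v ⌋) (interleavings a c))

  ∑-arrangements-#outputs : ∀ (ν : Vec ℕ N) a u c (h : List (Fin N) → ℤ) →
    isArrangement ν u ≡ true → sum c ≡ length u →
    ∑[ v ∈ arrangements ν ] (+ #outputs a u c v * h v) ≡ ∑[ L ∈ interleavings a c ] h (interleave (cut c u) L)
  ∑-arrangements-#outputs ν a u c h isArr sc = begin
    ∑[ v ∈ arrangements ν ] (+ #outputs a u c v * h v)
      ≡⟨ ∑ᴸ-cong (arrangements ν) (λ v → cong (_* h v) (trans (sym (∑ᴸ-one (filterᵇ (is-output v) (interleavings a c))))
                                                          (∑ᴸ-filterᵇ (is-output v) (interleavings a c) (λ _ → + 1)))) ⟩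
    ∑[ v ∈ arrangements ν ] (∑[ L ∈ interleavings a c ] ⟦ is-output v L ⟧ * h v)
      ≡⟨ ∑ᴸ-cong (arrangements ν) (λ v → *-distribʳ-∑ᴸ (h v) (interleavings a c) (λ L → ⟦ is-output v L ⟧)) ⟩
    ∑[ v ∈ arrangements ν ] ∑[ L ∈ interleavings a c ] (⟦ is-output v L ⟧ * h v)
      ≡⟨ ∑ᴸ-comm (arrangements ν) (interleavings a c) _ ⟩
    ∑[ L ∈ interleavings a c ] ∑[ v ∈ arrangements ν ] (⟦ is-output v L ⟧ * h v)
      ≡⟨ ∑ᴸ-cong-All (interleavings-sound a c) (λ L (L<a , valid) → single-output L L<a valid) ⟩
    ∑[ L ∈ interleavings a c ] h (interleave (cut c u) L) ∎
    where
    open ≡-Reasoning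
    is-output : List (Fin N) → List ℕ → Bool
    is-output v L = ⌊ ≡-dec _≟F_ (interleave (cut c u) L) v ⌋

    single-output : ∀ L → All (_< a) L → counts a L ≡ c →
      ∑[ v ∈ arrangements ν ] (⟦ is-output v L ⟧ * h v) ≡ h (interleave (cut c u) L)
    single-output L L<a valid = begin
      ∑[ v ∈ arrangements ν ] (⟦ ⌊ ≡-dec _≟F_ w v ⌋ ⟧ * h v)
        ≡⟨ ∑ᴸ-cong (arrangements ν) (λ v → at-w (≡-dec _≟F_ w v)) ⟩
      ∑[ v ∈ arrangements ν ] (⟦ ⌊ ≡-dec _≟F_ w v ⌋ ⟧ * h w)
        ≡⟨ *-distribʳ-∑ᴸ (h w) (arrangements ν) (λ v → ⟦ ⌊ ≡-dec _≟F_ w v ⌋ ⟧) ⟨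
      ∑[ v ∈ arrangements ν ] ⟦ ⌊ ≡-dec _≟F_ w v ⌋ ⟧ * h w
        ≡⟨ cong (_* h w) (∑-arrangements-⟦≟⟧ ν w (trans (isArrangement-↭ ν w↭u) isArr)) ⟩
      + 1 * h w
        ≡⟨ ℤ.*-identityˡ (h w) ⟩
      h w ∎
      where
      w = interleave (cut c u) L
      w↭u : w ↭ u
      w↭u = subst (w ↭_) (concat-cut c u sc)
                  (interleave-↭ a (cut c u) L L<a (trans valid (sym (sizes-cut c u sc))))
      at-w : ∀ {v} (w≟v : Dec (w ≡ v)) → ⟦ ⌊ w≟v ⌋ ⟧ * h v ≡ ⟦ ⌊ w≟v ⌋ ⟧ * h w
      at-w (yes refl) = refl
      at-w (no _)     = refl

ι : ℤ → ℚ
ι z = z ℚ./ 1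

fromℚᵘ-* : ∀ p q → ℚ.fromℚᵘ p ℚ.* ℚ.fromℚᵘ q ≡ ℚ.fromℚᵘ (p ℚᵘ.* q)
fromℚᵘ-* p q = ℚ.toℚᵘ-injective (ℚᵘ.≃-trans (ℚ.toℚᵘ-homo-* (ℚ.fromℚᵘ p) (ℚ.fromℚᵘ q))
  (ℚᵘ.≃-trans (ℚᵘ.*-cong (ℚ.toℚᵘ-fromℚᵘ p) (ℚ.toℚᵘ-fromℚᵘ q)) (ℚᵘ.≃-sym (ℚ.toℚᵘ-fromℚᵘ (p ℚᵘ.* q)))))

fromℚᵘ-+ : ∀ p q → ℚ.fromℚᵘ p ℚ.+ ℚ.fromℚᵘ q ≡ ℚ.fromℚᵘ (p ℚᵘ.+ q)
fromℚᵘ-+ p q = ℚ.toℚᵘ-injective (ℚᵘ.≃-trans (ℚ.toℚᵘ-homo-+ (ℚ.fromℚᵘ p) (ℚ.fromℚᵘ q))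
  (ℚᵘ.≃-trans (ℚᵘ.+-cong (ℚ.toℚᵘ-fromℚᵘ p) (ℚ.toℚᵘ-fromℚᵘ q)) (ℚᵘ.≃-sym (ℚ.toℚᵘ-fromℚᵘ (p ℚᵘ.+ q)))))

ι-+ : ∀ x y → ι (x + y) ≡ ι x ℚ.+ ι y
ι-+ x y = trans (ℚ.fromℚᵘ-cong {mkℚᵘ (x + y) 0} {mkℚᵘ x 0 ℚᵘ.+ mkℚᵘ y 0} (ℚᵘ.*≡* (cross x y)))
                (sym (fromℚᵘ-+ (mkℚᵘ x 0) (mkℚᵘ y 0)))
  where
  cross : ∀ (x y : ℤ) → (x + y) * + 1 ≡ (x * + 1 + y * + 1) * + 1
  cross = solve-∀

frac-cancel : ∀ m q x z .{{_ : ℕ.NonZero m}} .{{_ : ℕ.NonZero q}} →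
              frac m q ℚ.* frac x m ℚ.* ι z ≡ frac 1 q ℚ.* ι (+ x * z)
frac-cancel (suc m) (suc q) x z = begin
  ℚ.fromℚᵘ m/q ℚ.* ℚ.fromℚᵘ x/m ℚ.* ℚ.fromℚᵘ (mkℚᵘ z 0)
    ≡⟨ cong (ℚ._* ι z) (fromℚᵘ-* m/q x/m) ⟩
  ℚ.fromℚᵘ (m/q ℚᵘ.* x/m) ℚ.* ℚ.fromℚᵘ (mkℚᵘ z 0)
    ≡⟨ fromℚᵘ-* (m/q ℚᵘ.* x/m) (mkℚᵘ z 0) ⟩
  ℚ.fromℚᵘ (m/q ℚᵘ.* x/m ℚᵘ.* mkℚᵘ z 0)
    ≡⟨ ℚ.fromℚᵘ-cong {m/q ℚᵘ.* x/m ℚᵘ.* mkℚᵘ z 0} {mkℚᵘ (+ 1) q ℚᵘ.* mkℚᵘ (+ x * z) 0} (ℚᵘ.*≡* cross) ⟩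
  ℚ.fromℚᵘ (mkℚᵘ (+ 1) q ℚᵘ.* mkℚᵘ (+ x * z) 0)
    ≡⟨ fromℚᵘ-* (mkℚᵘ (+ 1) q) (mkℚᵘ (+ x * z) 0) ⟨
  frac 1 (suc q) ℚ.* ι (+ x * z) ∎
  where
  open ≡-Reasoning
  m/q = mkℚᵘ (+ suc m) q
  x/m = mkℚᵘ (+ x) m
  cross : ((+ suc m * + x) * z) * + (suc q ℕ.* 1) ≡ (+ 1 * (+ x * z)) * + ((suc q ℕ.* suc m) ℕ.* 1)
  cross = begin
    ((+ suc m * + x) * z) * + (suc q ℕ.* 1)
      ≡⟨ cong (((+ suc m * + x) * z) *_) (ℤ.pos-* (suc q) 1) ⟩
    ((+ suc m * + x) * z) * (+ suc q * + 1)
      ≡⟨ regroup (+ suc m) (+ x) z (+ suc q) ⟩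
    (+ 1 * (+ x * z)) * ((+ suc q * + suc m) * + 1)
      ≡⟨ cong (λ d → (+ 1 * (+ x * z)) * (d * + 1)) (ℤ.pos-* (suc q) (suc m)) ⟨
    (+ 1 * (+ x * z)) * (+ (suc q ℕ.* suc m) * + 1)
      ≡⟨ cong ((+ 1 * (+ x * z)) *_) (ℤ.pos-* (suc q ℕ.* suc m) 1) ⟨
    (+ 1 * (+ x * z)) * + ((suc q ℕ.* suc m) ℕ.* 1) ∎
    where
    regroup : ∀ (m x z q : ℤ) → ((m * x) * z) * (q * + 1) ≡ (+ 1 * (x * z)) * ((q * m) * + 1)
    regroup = solve-∀

frac-scale : ∀ a p z .{{_ : ℕ.NonZero a}} .{{_ : ℕ.NonZero p}} →
             frac 1 (a ℕ.* p) ℚ.* ι (+ p * z) ≡ frac 1 a ℚ.* ι z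
frac-scale (suc a) (suc p) z = begin
  frac 1 (suc a ℕ.* suc p) ℚ.* ι (+ suc p * z)
    ≡⟨ fromℚᵘ-* (mkℚᵘ (+ 1) (p ℕ.+ a ℕ.* suc p)) (mkℚᵘ (+ suc p * z) 0) ⟩
  ℚ.fromℚᵘ (mkℚᵘ (+ 1) (p ℕ.+ a ℕ.* suc p) ℚᵘ.* mkℚᵘ (+ suc p * z) 0)
    ≡⟨ ℚ.fromℚᵘ-cong {mkℚᵘ (+ 1) (p ℕ.+ a ℕ.* suc p) ℚᵘ.* mkℚᵘ (+ suc p * z) 0} {mkℚᵘ (+ 1) a ℚᵘ.* mkℚᵘ z 0}
                      (ℚᵘ.*≡* cross) ⟩
  ℚ.fromℚᵘ (mkℚᵘ (+ 1) a ℚᵘ.* mkℚᵘ z 0)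
    ≡⟨ fromℚᵘ-* (mkℚᵘ (+ 1) a) (mkℚᵘ z 0) ⟨
  frac 1 (suc a) ℚ.* ι z ∎
  where
  open ≡-Reasoning
  cross : (+ 1 * (+ suc p * z)) * + (suc a ℕ.* 1) ≡ (+ 1 * z) * + ((suc a ℕ.* suc p) ℕ.* 1)
  cross = begin
    (+ 1 * (+ suc p * z)) * + (suc a ℕ.* 1)
      ≡⟨ cong ((+ 1 * (+ suc p * z)) *_) (ℤ.pos-* (suc a) 1) ⟩
    (+ 1 * (+ suc p * z)) * (+ suc a * + 1)
      ≡⟨ regroup (+ suc p) z (+ suc a) ⟩
    (+ 1 * z) * ((+ suc a * + suc p) * + 1)
      ≡⟨ cong (λ d → (+ 1 * z) * (d * + 1)) (ℤ.pos-* (suc a) (suc p)) ⟨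
    (+ 1 * z) * (+ (suc a ℕ.* suc p) * + 1)
      ≡⟨ cong ((+ 1 * z) *_) (ℤ.pos-* (suc a ℕ.* suc p) 1) ⟨
    (+ 1 * z) * + ((suc a ℕ.* suc p) ℕ.* 1) ∎
    where
    regroup : ∀ (p z a : ℤ) → (+ 1 * (p * z)) * (a * + 1) ≡ (+ 1 * z) * ((a * p) * + 1)
    regroup = solve-∀

module _ {A : Set} where

  sumℚ-cong-All : {P : A → Set} {xs : List A} → All P xs → {g h : A → ℚ} →
                  (∀ x → P x → g x ≡ h x) → sumℚ (map g xs) ≡ sumℚ (map h xs)
  sumℚ-cong-All []         g≗h = refl
  sumℚ-cong-All (px ∷ pxs) g≗h = cong₂ ℚ._+_ (g≗h _ px) (sumℚ-cong-All pxs g≗h)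

  sumℚ-*ʳ : (xs : List A) (g : A → ℚ) (q : ℚ) → sumℚ (map g xs) ℚ.* q ≡ sumℚ (map (λ x → g x ℚ.* q) xs)
  sumℚ-*ʳ []       g q = ℚ.*-zeroˡ q
  sumℚ-*ʳ (x ∷ xs) g q = trans (ℚ.*-distribʳ-+ q (g x) _) (cong (ℚ._+_ (g x ℚ.* q)) (sumℚ-*ʳ xs g q))

  sumℚ-ι : (xs : List A) (q : ℚ) (h : A → ℤ) → sumℚ (map (λ x → q ℚ.* ι (h x)) xs) ≡ q ℚ.* ι (∑ᴸ xs h)
  sumℚ-ι []       q h = sym (ℚ.*-zeroʳ q)
  sumℚ-ι (x ∷ xs) q h = begin
    q ℚ.* ι (h x) ℚ.+ sumℚ (map (λ x → q ℚ.* ι (h x)) xs)  ≡⟨ cong (ℚ._+_ (q ℚ.* ι (h x))) (sumℚ-ι xs q h) ⟩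
    q ℚ.* ι (h x) ℚ.+ q ℚ.* ι (∑ᴸ xs h)                     ≡⟨ ℚ.*-distribˡ-+ q (ι (h x)) _ ⟨
    q ℚ.* (ι (h x) ℚ.+ ι (∑ᴸ xs h))                         ≡⟨ cong (q ℚ.*_) (ι-+ (h x) (∑ᴸ xs h)) ⟨
    q ℚ.* ι (h x + ∑ᴸ xs h)                                  ∎
    where open ≡-Reasoning

-- The eigenvalue equation

module _ {N : ℕ} where

  K-*-ι : ∀ a (u v : List (Fin N)) z → K (suc a) u v ℚ.* ι z
    ≡ frac 1 (suc a ℕ.^ length u) ℚ.* ι (∑[ c ∈ comps (suc a) (length u) ] (+ #outputs (suc a) u c v * z))
  K-*-ι a u v z = trans (sumℚ-*ʳ (comps (suc a) (length u)) _ (ι z))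
    (trans (sumℚ-cong-All (comps-sound (suc a) (length u)) weight-cancels)
           (sumℚ-ι (comps (suc a) (length u)) (frac 1 (suc a ℕ.^ length u)) (λ c → + #outputs (suc a) u c v * z)))
    where
    weight-cancels : ∀ c → length c ≡ suc a × sum c ≡ length u →
      frac (multinomial c) (suc a ℕ.^ length u) ℚ.* frac (#outputs (suc a) u c v) (length (interleavings (suc a) c))
        ℚ.* ι z
        ≡ frac 1 (suc a ℕ.^ length u) ℚ.* ι (+ #outputs (suc a) u c v * z)
    weight-cancels c (lc , _) rewrite length-interleavings (suc a) c lc =
      frac-cancel (multinomial c) (suc a ℕ.^ length u) _ z
        {{ℕ.>-nonZero (multinomial>0 c)}} {{ℕ.m^n≢0 (suc a) (length u)}}

  ∑-interleavings-cut : ∀ a c (u : List (Fin N)) → length c ≡ a → sum c ≡ length u →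
    ∑[ L ∈ interleavings a c ] ascMinusDescℤ (interleave (cut c u) L) ≡ cutTotal a u c
  ∑-interleavings-cut a c u lc sc = begin
    ∑[ L ∈ interleavings a c ] ascMinusDescℤ (interleave (cut c u) L)
      ≡⟨ cong (λ d → ∑[ L ∈ interleavings a d ] ascMinusDescℤ (interleave (cut c u) L)) (sizes-cut c u sc) ⟨
    ∑[ L ∈ interleavings a (sizes (cut c u)) ] ascMinusDescℤ (interleave (cut c u) L)
      ≡⟨ ∑-ascMinusDesc-interleave a (cut c u)
           (trans (sym (length-map length (cut c u))) (trans (cong length (sizes-cut c u sc)) lc)) ⟩
    ∑[ k < a ] (ascMinusDescℤ (packet (cut c u) (toℕ k)) * + multinomial (decAt (toℕ k) (sizes (cut c u))))
      ≡⟨ cong (λ d → ∑[ k < a ] (ascMinusDescℤ (packet (cut c u) (toℕ k)) * + multinomial (decAt (toℕ k) d)))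
              (sizes-cut c u sc) ⟩
    cutTotal a u c ∎
    where open ≡-Reasoning

  ∑-outputs-ascMinusDesc : ∀ (ν : Vec ℕ N) a u → isArrangement ν u ≡ true →
    ∑[ v ∈ arrangements ν ] ∑[ c ∈ comps a (length u) ] (+ #outputs a u c v * ascMinusDescℤ v)
      ≡ + (a ℕ.^ (length u ∸ 1)) * ascMinusDescℤ u
  ∑-outputs-ascMinusDesc ν a u isArr = begin
    ∑[ v ∈ arrangements ν ] ∑[ c ∈ comps a (length u) ] (+ #outputs a u c v * ascMinusDescℤ v)
      ≡⟨ ∑ᴸ-comm (arrangements ν) (comps a (length u)) _ ⟩
    ∑[ c ∈ comps a (length u) ] ∑[ v ∈ arrangements ν ] (+ #outputs a u c v * ascMinusDescℤ v)
      ≡⟨ ∑ᴸ-cong-All (comps-sound a (length u)) (λ c (lc , sc) →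
           trans (∑-arrangements-#outputs ν a u c ascMinusDescℤ isArr sc) (∑-interleavings-cut a c u lc sc)) ⟩
    ∑[ c ∈ comps a (length u) ] cutTotal a u c
      ≡⟨ ∑-cutTotal a (length u) u refl ⟩
    + (a ℕ.^ (length u ∸ 1)) * ascMinusDescℤ u ∎
    where open ≡-Reasoning

  eigen-scaling : ∀ a (u : List (Fin N)) →
    frac 1 (suc a ℕ.^ length u) ℚ.* ι (+ (suc a ℕ.^ (length u ∸ 1)) * ascMinusDescℤ u) ≡ frac 1 (suc a) ℚ.* ascMinusDesc u
  eigen-scaling a []      = sym (ℚ.*-zeroʳ (frac 1 (suc a)))
  eigen-scaling a (x ∷ w) =
    frac-scale (suc a) (suc a ℕ.^ length w) (ascMinusDescℤ (x ∷ w)) {{_}} {{ℕ.m^n≢0 (suc a) (length w)}}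

proposition5p14 : (N : ℕ) (ν : Vec ℕ N) → (∀ i → 1 ≤ lookup ν i) →
    (a : ℕ) → 1 ≤ a →
    IsRightEigenfunction a ν ascMinusDesc (frac 1 a)
proposition5p14 N ν _ (suc a) _ u isArr = begin
  sumℚ (map (λ v → K (suc a) u v ℚ.* ascMinusDesc v) (arrangements ν))
    ≡⟨ cong sumℚ (map-cong (λ v → K-*-ι a u v (ascMinusDescℤ v)) (arrangements ν)) ⟩
  sumℚ (map (λ v → frac 1 (suc a ℕ.^ n) ℚ.* ι (∑[ c ∈ comps (suc a) n ] (+ #outputs (suc a) u c v * ascMinusDescℤ v)))
            (arrangements ν))
    ≡⟨ sumℚ-ι (arrangements ν) (frac 1 (suc a ℕ.^ n)) _ ⟩
  frac 1 (suc a ℕ.^ n) ℚ.* ι (∑[ v ∈ arrangements ν ] ∑[ c ∈ comps (suc a) n ] (+ #outputs (suc a) u c v * ascMinusDescℤ v))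
    ≡⟨ cong (λ z → frac 1 (suc a ℕ.^ n) ℚ.* ι z) (∑-outputs-ascMinusDesc ν (suc a) u isArr) ⟩
  frac 1 (suc a ℕ.^ n) ℚ.* ι (+ (suc a ℕ.^ (n ∸ 1)) * ascMinusDescℤ u)
    ≡⟨ eigen-scaling a u ⟩
  frac 1 (suc a) ℚ.* ascMinusDesc u ∎
  where
  open ≡-Reasoning
  n = length u
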